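{- Let $L\subseteq\{0,1\}^*$. The following are equivalent: (i) there exists a recurrent bi-infinite word $\xi$ with $F(\xi)=L$; (ii) all of the following hold: (a) $L$ contains a non-empty word; (b) if $uvw\in L$ with $u,v,w\in\{0,1\}^*$ then $v\in L$; (c) for all $u,w\in L$ there is a finite word $v$ with $uvw\in L$. In addition, $\xi$ in (i) can be chosen recursive if and only if $L$ is recursively enumerable.
   Context: A bi-infinite word is a map $\xi\colon\mathbb Z\to\{0,1\}$. For $i\le j$, $\xi[i,j]$ is the finite word $\xi(i)\xi(i+1)\cdots\xi(j)$. $F(\xi)$, the set of factors of $\xi$, consists of all $\xi[i,j]$ with $i\le j$ together with the empty word. For $i\in\mathbb Z$, $\xi[i,\infty)$ is the $\omega$-word $\xi(i)\xi(i+1)\cdots$ and $\xi(-\infty,i]$ is the left-infinite word $\cdots\xi(i-1)\xi(i)$; their factor sets are defined analogously. $\xi$ is recurrent if $F(\xi)=F(\xi(-\infty,i])=F(\xi[i,\infty))$ for all $i\in\mathbb Z$. A bi-infinite word is recursive if the set $\{2i\mid i\ge0,\xi(i)=1\}\cup\{2i+1\mid i>0,\xi(-i)=1\}$ is recursive; sets of finite words are identified with subsets of $\mathbb N$ via a fixed effective enumeration of $\{0,1\}^*$. -}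

module Defs where

open import Data.Bool using (Bool; true; false; if_then_else_)
open import Data.Nat as ℕ using (ℕ; zero; suc; _<_)
open import Data.Nat.DivMod using (_/_; _%_)
open import Data.Fin using (Fin)
open import Data.Vec using (Vec; []; _∷_; lookup)
open import Data.List using (List; []; _∷_; _++_)
open import Data.Integer as ℤ using (ℤ; +_)
open import Data.Product using (Σ; ∃; _×_)
open import Data.Sum using (_⊎_)
open import Relation.Binary.PropositionalEquality using (_≡_; _≢_)
open import Relation.Nullary using (¬_)
open import Function.Bundles using (_⇔_)

-- Words. The letter 0 is 'false', the letter 1 is 'true'.

Word : Set
Word = List Bool

BiWord : Set
BiWord = ℤ → Bool

seg : BiWord → ℤ → ℕ → Word
seg ξ i zero    = []
seg ξ i (suc k) = ξ i ∷ seg ξ (i ℤ.+ ℤ.1ℤ) k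

-- F(ξ): all ξ[i,j] (i ≤ j) together with the empty word (= seg of length 0).
InF : BiWord → Word → Set
InF ξ w = Σ ℤ λ i → Σ ℕ λ k → w ≡ seg ξ i k

InFRight : BiWord → ℤ → Word → Set
InFRight ξ i w = Σ ℤ λ j → Σ ℕ λ k → i ℤ.≤ j × w ≡ seg ξ j k

-- F(ξ(-∞,i]): factors ending at a position ≤ i (last index j+k-1 ≤ i).
InFLeft : BiWord → ℤ → Word → Set
InFLeft ξ i w = Σ ℤ λ j → Σ ℕ λ k → j ℤ.+ (+ k) ℤ.≤ i ℤ.+ ℤ.1ℤ × w ≡ seg ξ j k

Recurrent : BiWord → Set
Recurrent ξ = (i : ℤ) → (w : Word) →
  (InF ξ w ⇔ InFLeft ξ i w) × (InF ξ w ⇔ InFRight ξ i w)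

Lang : Set
Lang = Word → Bool

FactorsAre : BiWord → Lang → Set
FactorsAre ξ L = (w : Word) → InF ξ w ⇔ (L w ≡ true)

CondA CondB CondC : Lang → Set
CondA L = Σ Word λ w → w ≢ [] × L w ≡ true
CondB L = (u v w : Word) → L (u ++ v ++ w) ≡ true → L v ≡ true
CondC L = (u w : Word) → L u ≡ true → L w ≡ true →
          Σ Word λ v → L (u ++ v ++ w) ≡ true

CondII : Lang → Set
CondII L = CondA L × CondB L × CondC L

data Code : ℕ → Set where
  zer  : ∀ {n} → Code n
  succ : Code 1
  proj : ∀ {n} → Fin n → Code n
  comp : ∀ {n m} → Code m → Vec (Code n) m → Code n
  prec : ∀ {n} → Code n → Code (suc (suc n)) → Code (suc n)
  mu   : ∀ {n} → Code (suc n) → Code n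

mutual
  data _⟦_⟧⇓_ : ∀ {n} → Code n → Vec ℕ n → ℕ → Set where
    ev-zer  : ∀ {n} {xs : Vec ℕ n} → zer ⟦ xs ⟧⇓ 0
    ev-succ : ∀ {x} → succ ⟦ x ∷ [] ⟧⇓ suc x
    ev-proj : ∀ {n} {i : Fin n} {xs} → proj i ⟦ xs ⟧⇓ lookup xs i
    ev-comp : ∀ {n m} {f : Code m} {gs : Vec (Code n) m} {xs ys y} →
              gs ⟦ xs ⟧⇓* ys → f ⟦ ys ⟧⇓ y → comp f gs ⟦ xs ⟧⇓ y
    ev-prec0 : ∀ {n} {f : Code n} {g} {xs y} →
               f ⟦ xs ⟧⇓ y → prec f g ⟦ 0 ∷ xs ⟧⇓ y
    ev-precS : ∀ {n} {f : Code n} {g} {k xs r y} →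
               prec f g ⟦ k ∷ xs ⟧⇓ r → g ⟦ k ∷ r ∷ xs ⟧⇓ y →
               prec f g ⟦ suc k ∷ xs ⟧⇓ y
    ev-mu   : ∀ {n} {f : Code (suc n)} {xs m} →
              f ⟦ m ∷ xs ⟧⇓ 0 →
              ((k : ℕ) → k < m → Σ ℕ λ v → f ⟦ k ∷ xs ⟧⇓ suc v) →
              mu f ⟦ xs ⟧⇓ m

  data _⟦_⟧⇓*_ : ∀ {n m} → Vec (Code n) m → Vec ℕ n → Vec ℕ m → Set where
    ev-[] : ∀ {n} {xs : Vec ℕ n} → [] ⟦ xs ⟧⇓* []
    ev-∷  : ∀ {n m} {g : Code n} {gs : Vec (Code n) m} {xs y ys} →
            g ⟦ xs ⟧⇓ y → gs ⟦ xs ⟧⇓* ys → (g ∷ gs) ⟦ xs ⟧⇓* (y ∷ ys)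

RecursiveSet : (ℕ → Set) → Set
RecursiveSet P = Σ (Code 1) λ e → (n : ℕ) →
  (P n → e ⟦ n ∷ [] ⟧⇓ 1) × (¬ P n → e ⟦ n ∷ [] ⟧⇓ 0)

RESet : (ℕ → Set) → Set
RESet P = Σ (Code 1) λ e → (n : ℕ) → P n ⇔ (Σ ℕ λ y → e ⟦ n ∷ [] ⟧⇓ y)

-- Fixed effective enumeration of {0,1}*: bijective base-2 numbering
-- (ε ↦ 0, and  b w ↦ 2·code(w) + 1 + b).
encode : Word → ℕ
encode []          = 0
encode (false ∷ w) = suc (2 ℕ.* encode w)
encode (true ∷ w)  = suc (suc (2 ℕ.* encode w))

LangAsSet : Lang → ℕ → Set
LangAsSet L n = Σ Word λ w → encode w ≡ n × L w ≡ true

RELang : Lang → Set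
RELang L = RESet (LangAsSet L)

-- {2i | i ≥ 0, ξ(i)=1} ∪ {2i+1 | i > 0, ξ(-i)=1}, as a Boolean predicate on ℕ.
wordBit : BiWord → ℕ → Bool
wordBit ξ n with n % 2 | n / 2
... | zero  | i     = ξ (+ i)
... | suc _ | zero  = false
... | suc _ | suc j = ξ (ℤ.- (+ suc j))

RecursiveBiWord : BiWord → Set
RecursiveBiWord ξ = RecursiveSet (λ n → wordBit ξ n ≡ true)

module Submission where

-- (i) ⇒ (ii) is read off the definitions (Characterisation.NecessaryConditions).
-- (ii) ⇒ (i) is a limit construction (Windows): nested words W₀ ⊑ W₁ ⊑ ... of L,
-- each W_{n+1} = A v₁ A v₂ A with A = W_n v ℓ_n v' W_n for an enumeration ℓ_n of L
-- in which every word recurs, converge to a recurrent ξ with F(ξ) = L.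
-- Recursive ⇒ r.e. (RecursiveWordToRE): by recurrence w ∈ L iff w occurs at some
-- position j ≥ 0, which is a μ-search.  R.e. ⇒ recursive (REToRecursiveWord):
-- the construction is run with effective connectors and enumeration obtained by
-- dovetailing a clocked evaluator, so W_n and its origin p_n are computable.

open import Defs
open import Data.Product using (Σ; _×_; _,_)
open import Function.Bundles using (_⇔_; mk⇔)


module Computability where
  open import Defs
  open import Data.Nat using (ℕ; zero; suc; _+_; _*_; _∸_; _<_; s≤s; pred)
  open import Data.Nat.Properties using (pred[m∸n]≡m∸[1+n]; 0∸n≡0)
  open import Data.Fin using (Fin; zero; suc)
  open import Data.Vec using (Vec; []; _∷_; lookup)
  open import Data.Product using (Σ; _,_; proj₁; _×_)
  open import Relation.Binary.PropositionalEquality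
  open import Relation.Nullary using (¬_)
  open import Data.Empty using (⊥-elim)

  Fn : ℕ → Set
  Fn n = Vec ℕ n → ℕ

  Computable : ∀ {n} → Fn n → Set
  Computable {n} f = Σ (Code n) λ e → ∀ xs → e ⟦ xs ⟧⇓ f xs

  unary : (ℕ → ℕ) → Fn 1
  unary f (x ∷ []) = f x

  binary : (ℕ → ℕ → ℕ) → Fn 2
  binary f (x ∷ y ∷ []) = f x y

  ternary : (ℕ → ℕ → ℕ → ℕ) → Fn 3
  ternary f (x ∷ y ∷ z ∷ []) = f x y z

  Computable₁ : (ℕ → ℕ) → Set
  Computable₁ f = Computable (unary f)

  Computable₂ : (ℕ → ℕ → ℕ) → Set
  Computable₂ f = Computable (binary f)

  Computable₃ : (ℕ → ℕ → ℕ → ℕ) → Set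
  Computable₃ f = Computable (ternary f)

  data Computables {n : ℕ} : ∀ {m} → (Vec ℕ n → Vec ℕ m) → Set where
    []c : Computables (λ _ → [])
    _∷c_ : ∀ {m f} {G : Vec ℕ n → Vec ℕ m} →
           Computable f → Computables G → Computables (λ xs → f xs ∷ G xs)
  infixr 5 _∷c_

  codes : ∀ {n m G} → Computables {n} {m} G → Vec (Code n) m
  codes []c = []
  codes ((e , _) ∷c cs) = e ∷ codes cs

  codes-ok : ∀ {n m G} (cs : Computables {n} {m} G) xs → codes cs ⟦ xs ⟧⇓* G xs
  codes-ok []c xs = ev-[]
  codes-ok ((e , p) ∷c cs) xs = ev-∷ (p xs) (codes-ok cs xs)

  cExt : ∀ {n} {f g : Fn n} → Computable f → (∀ xs → f xs ≡ g xs) → Computable g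
  cExt (e , p) q = e , λ xs → subst (e ⟦ xs ⟧⇓_) (q xs) (p xs)

  cZ : ∀ {n} → Computable {n} (λ _ → 0)
  cZ = zer , λ _ → ev-zer

  cP : ∀ {n} (i : Fin n) → Computable (λ xs → lookup xs i)
  cP i = proj i , λ _ → ev-proj

  cS : Computable₁ suc
  cS = succ , λ { (x ∷ []) → ev-succ }

  cC : ∀ {n m f} {G : Vec ℕ n → Vec ℕ m} → Computable f → Computables G →
       Computable (λ xs → f (G xs))
  cC (e , p) cs = comp e (codes cs) , λ xs → ev-comp (codes-ok cs xs) (p _)

  recN : ∀ {n} → Fn n → Fn (suc (suc n)) → ℕ → Vec ℕ n → ℕ
  recN f g zero xs = f xs
  recN f g (suc k) xs = g (k ∷ recN f g k xs ∷ xs)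

  precF : ∀ {n} → Fn n → Fn (suc (suc n)) → Fn (suc n)
  precF f g (k ∷ xs) = recN f g k xs

  cR : ∀ {n} {f : Fn n} {g} → Computable f → Computable g → Computable (precF f g)
  cR {f = f} {g} (e , p) (e' , p') = prec e e' , λ { (k ∷ xs) → go k xs }
    where go : ∀ k xs → prec e e' ⟦ k ∷ xs ⟧⇓ recN f g k xs
          go zero xs = ev-prec0 (p xs)
          go (suc k) xs = ev-precS (go k xs) (p' _)

  _$1_ : ∀ {n f} {g : Fn n} → Computable₁ f → Computable g → Computable (λ xs → f (g xs))
  c $1 d = cC c (d ∷c []c)
  infixr 4 _$1_

  ap2 : ∀ {n f} {g h : Fn n} → Computable₂ f → Computable g → Computable h →
        Computable (λ xs → f (g xs) (h xs))
  ap2 c d d' = cC c (d ∷c d' ∷c []c)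

  NZ : ℕ → Set
  NZ x = ¬ x ≡ 0

  LeastRoot : (ℕ → ℕ) → ℕ → Set
  LeastRoot f m = f m ≡ 0 × (∀ k → k < m → NZ (f k))

  muOK : ∀ {n} {f : Fn (suc n)} (c : Computable f) xs m →
         LeastRoot (λ k → f (k ∷ xs)) m → mu (proj₁ c) ⟦ xs ⟧⇓ m
  muOK {f = f} (e , p) xs m (z , nz) = ev-mu (subst (e ⟦ m ∷ xs ⟧⇓_) z (p _)) halts
    where halts : ∀ k → k < m → Σ ℕ λ v → e ⟦ k ∷ xs ⟧⇓ suc v
          halts k k<m with f (k ∷ xs) | p (k ∷ xs) | nz k k<m
          ... | zero | _ | f≢0 = ⊥-elim (f≢0 refl)
          ... | suc v | d | _ = v , d

  leastRoot : (f : ℕ → ℕ) (m : ℕ) → f m ≡ 0 → Σ ℕ (LeastRoot f)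
  leastRoot f m z with f 0 in f0
  ... | zero = 0 , f0 , λ k ()
  leastRoot f zero z | suc _ with () <- trans (sym f0) z
  leastRoot f (suc m) z | suc _ with leastRoot (λ k → f (suc k)) m z
  ... | m' , z' , nz = suc m' , z' , below
    where below : ∀ k → k < suc m' → NZ (f k)
          below zero _ q with () <- trans (sym f0) q
          below (suc k) (s≤s k<m') = nz k k<m'

  -- Arithmetic. nsg x = [x = 0] and sg x = [x ≠ 0] serve as Boolean tests.
  c1 : ∀ {n} → Computable {n} (λ _ → 1)
  c1 = cS $1 cZ

  cAdd : Computable₂ _+_
  cAdd = cExt (cR (cP zero) (cS $1 cP (suc zero))) λ { (k ∷ x ∷ []) → go k x }
    where go : ∀ k x → recN (λ xs → lookup xs zero) (λ xs → suc (lookup xs (suc zero))) k (x ∷ []) ≡ k + x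
          go zero x = refl
          go (suc k) x = cong suc (go k x)

  cMul : Computable₂ _*_
  cMul = cExt (cR cZ (ap2 cAdd (cP (suc (suc zero))) (cP (suc zero)))) λ { (k ∷ x ∷ []) → go k x }
    where go : ∀ k x → recN (λ _ → 0) (λ xs → lookup xs (suc (suc zero)) + lookup xs (suc zero)) k (x ∷ []) ≡ k * x
          go zero x = refl
          go (suc k) x = cong (x +_) (go k x)

  cPred : Computable₁ pred
  cPred = cExt (cR {n = 0} cZ (cP zero)) λ { (zero ∷ []) → refl ; (suc k ∷ []) → refl }

  cMonus : Computable₂ _∸_
  cMonus = cExt (ap2 flipped (cP (suc zero)) (cP zero)) λ { (x ∷ y ∷ []) → refl }
    where
      flipped : Computable₂ (λ y x → x ∸ y)
      flipped = cExt (cR (cP zero) (cPred $1 cP (suc zero))) λ { (y ∷ x ∷ []) → go y x }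
        where go : ∀ y x → recN (λ xs → lookup xs zero) (λ xs → pred (lookup xs (suc zero))) y (x ∷ []) ≡ x ∸ y
              go zero x = refl
              go (suc y) x = trans (cong pred (go y x)) (pred[m∸n]≡m∸[1+n] x y)

  nsg : ℕ → ℕ
  nsg x = 1 ∸ x

  sg : ℕ → ℕ
  sg x = 1 ∸ (1 ∸ x)

  sg-suc : ∀ x → sg (suc x) ≡ 1
  sg-suc x rewrite 0∸n≡0 x = refl

  nsg-suc : ∀ x → nsg (suc x) ≡ 0
  nsg-suc x = 0∸n≡0 x

  cNsg : Computable₁ nsg
  cNsg = cExt (ap2 cMonus c1 (cP zero)) λ { (x ∷ []) → refl }

  cSg : Computable₁ sg
  cSg = cExt (cNsg $1 cNsg $1 cP zero) λ { (x ∷ []) → refl }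

  pw : ℕ → ℕ
  pw zero = 1
  pw (suc k) = pw k + pw k

  cPw : Computable₁ pw
  cPw = cExt (cR {n = 0} c1 (ap2 cAdd (cP (suc zero)) (cP (suc zero)))) λ { (k ∷ []) → go k }
    where go : ∀ k → recN (λ _ → 1) (λ xs → lookup xs (suc zero) + lookup xs (suc zero)) k [] ≡ pw k
          go zero = refl
          go (suc k) = cong₂ _+_ (go k) (go k)

  eqN : ℕ → ℕ → ℕ
  eqN x y = nsg ((x ∸ y) + (y ∸ x))

  cEq : Computable₂ eqN
  cEq = cExt (cNsg $1 ap2 cAdd (ap2 cMonus (cP zero) (cP (suc zero))) (ap2 cMonus (cP (suc zero)) (cP zero)))
             λ { (x ∷ y ∷ []) → refl }

module ClockedEvaluator where
  open import Defs
  open Computability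
  open import Data.Nat using (ℕ; zero; suc; _+_; _*_; _∸_; pred)
  open import Data.Fin using (Fin; zero; suc; _↑ʳ_)
  open import Data.Vec using (Vec; []; _∷_; lookup; head; tail; map; tabulate)
  open import Data.Vec.Properties using (tabulate∘lookup)
  open import Data.Product using (_,_)
  open import Relation.Binary.PropositionalEquality

  -- A clocked evaluator for codes.  evalC t e xs is 0 when the run is not (yet)
  -- seen to halt and suc y when it halts with output y; the clock t bounds each
  -- unbounded search.  Being total and primitive-recursive in the code's shape,
  -- evalC t e is itself computable (cEval below), which is the universal-machine
  -- fact used to simulate a recursive enumeration.

  prodV : ∀ {m} → Vec ℕ m → ℕ
  prodV [] = 1
  prodV (x ∷ xs) = x * prodV xs

  -- The search state for μ: 1 = searching, 0 = a probe diverged,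
  -- suc (suc m) = the least root m was found.
  eq1 : ℕ → ℕ
  eq1 x = eqN x 1

  searchProbe : ℕ → ℕ → ℕ
  searchProbe b r = sg r * (eq1 r * (b + 2) + nsg (eq1 r))

  searchStep : ℕ → ℕ → ℕ → ℕ
  searchStep s b r = eq1 s * searchProbe b r + nsg (eq1 s) * s

  muSearch : (ℕ → ℕ) → ℕ → ℕ
  muSearch h zero = 1
  muSearch h (suc b) = searchStep (muSearch h b) b (h b)

  -- Primitive recursion on "halted" values (0 propagates divergence).
  precE : ∀ {n} → Fn n → Fn (suc (suc n)) → ℕ → Vec ℕ n → ℕ
  precE F G zero xs = F xs
  precE F G (suc k) xs = sg (precE F G k xs) * G (k ∷ pred (precE F G k xs) ∷ xs)

  mutual
    evalC : ∀ {n} → ℕ → Code n → Vec ℕ n → ℕ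
    evalC t zer xs = 1
    evalC t succ (x ∷ []) = suc (suc x)
    evalC t (proj i) xs = suc (lookup xs i)
    evalC t (comp f gs) xs = sg (prodV (evalsC t gs xs)) * evalC t f (map pred (evalsC t gs xs))
    evalC t (prec f g) (k ∷ xs) = precE (evalC t f) (evalC t g) k xs
    evalC t (mu f) xs = muSearch (λ b → evalC t f (b ∷ xs)) (suc t) ∸ 1

    evalsC : ∀ {n m} → ℕ → Vec (Code n) m → Vec ℕ n → Vec ℕ m
    evalsC t [] xs = []
    evalsC t (g ∷ gs) xs = evalC t g xs ∷ evalsC t gs xs

  tabC : ∀ {n m} (σ : Fin m → Fin n) → Computables {n} (λ v → tabulate (λ i → lookup v (σ i)))
  tabC {m = zero} σ = []c
  tabC {m = suc m} σ = cP (σ zero) ∷c tabC (λ i → σ (suc i))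

  cProd : ∀ {n m} {G : Vec ℕ n → Vec ℕ m} → Computables G → Computable (λ v → prodV (G v))
  cProd []c = c1
  cProd (c ∷c cs) = ap2 cMul c (cProd cs)

  mapPred : ∀ {n m} {G : Vec ℕ n → Vec ℕ m} → Computables G → Computables (λ v → map pred (G v))
  mapPred []c = []c
  mapPred (c ∷c cs) = (cPred $1 c) ∷c mapPred cs

  cEq1 : Computable₁ eq1
  cEq1 = cExt (ap2 cEq (cP zero) c1) λ { (x ∷ []) → refl }

  cSearchStep : Computable₃ searchStep
  cSearchStep = cExt (ap2 cAdd (ap2 cMul e1s (ap2 cMul (cSg $1 r) (ap2 cAdd (ap2 cMul (cEq1 $1 r) (ap2 cAdd b (cS $1 cS $1 cZ))) (cNsg $1 cEq1 $1 r))))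
                          (ap2 cMul (cNsg $1 e1s) s))
           λ { (s ∷ b ∷ r ∷ []) → refl }
    where s = cP {3} zero
          b = cP {3} (suc zero)
          r = cP {3} (suc (suc zero))
          e1s = cEq1 $1 s

  evalFn : ∀ {n} → Code n → Fn (suc n)
  evalFn e v = evalC (head v) e (tail v)

  mutual
    cEval : ∀ {n} (e : Code n) → Computable (evalFn e)
    cEval zer = cExt c1 λ { (t ∷ xs) → refl }
    cEval succ = cExt (cS $1 cS $1 cP (suc zero)) λ { (t ∷ x ∷ []) → refl }
    cEval (proj i) = cExt (cS $1 cP (suc i)) λ { (t ∷ xs) → refl }
    cEval (comp f gs) = cExt (ap2 cMul (cSg $1 cProd (cEvals gs)) (cC (cEval f) (cP zero ∷c mapPred (cEvals gs))))
                          λ { (t ∷ xs) → refl }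
    cEval {suc n} (prec f g) = cExt (cC Q (cP (suc zero) ∷c cP zero ∷c tabC ((2 ↑ʳ_))))
                          λ { (t ∷ k ∷ xs) → trans (cong (λ z → recN (evalFn f) G k (t ∷ z)) (tabulate∘lookup xs)) (lem t k xs) }
      where
        G : Fn (suc (suc (suc n)))
        G (k ∷ r ∷ t ∷ xs) = sg r * evalC t g (k ∷ pred r ∷ xs)
        cG : Computable G
        cG = cExt (ap2 cMul (cSg $1 cP (suc zero)) (cC (cEval g) (cP (suc (suc zero)) ∷c cP zero ∷c (cPred $1 cP (suc zero)) ∷c tabC ((3 ↑ʳ_)))))
                  λ { (k ∷ r ∷ t ∷ xs) → cong (λ z → sg r * evalC t g (k ∷ pred r ∷ z)) (tabulate∘lookup xs) }
        Q : Computable (precF (evalFn f) G)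
        Q = cR (cEval f) cG
        lem : ∀ t k xs → recN (evalFn f) G k (t ∷ xs) ≡ precE (evalC t f) (evalC t g) k xs
        lem t zero xs = refl
        lem t (suc k) xs rewrite lem t k xs = refl
    cEval {n} (mu f) = cExt (ap2 cMonus (cC Sc ((cS $1 cP zero) ∷c cP zero ∷c tabC ((1 ↑ʳ_)))) c1)
                    λ { (t ∷ xs) → cong (_∸ 1) (trans (cong (λ z → recN (λ _ → 1) St (suc t) (t ∷ z)) (tabulate∘lookup xs)) (lem t (suc t) xs)) }
      where
        St : Fn (suc (suc (suc n)))
        St (b ∷ s ∷ t ∷ xs) = searchStep s b (evalC t f (b ∷ xs))
        cSt : Computable St
        cSt = cExt (cC cSearchStep (cP (suc zero) ∷c cP zero ∷c cC (cEval f) (cP (suc (suc zero)) ∷c cP zero ∷c tabC ((3 ↑ʳ_))) ∷c []c))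
                   λ { (b ∷ s ∷ t ∷ xs) → cong (λ z → searchStep s b (evalC t f (b ∷ z))) (tabulate∘lookup xs) }
        Sc : Computable (precF (λ _ → 1) St)
        Sc = cR c1 cSt
        lem : ∀ t b xs → recN (λ _ → 1) St b (t ∷ xs) ≡ muSearch (λ b → evalC t f (b ∷ xs)) b
        lem t zero xs = refl
        lem t (suc b) xs rewrite lem t b xs = refl

    cEvals : ∀ {n m} (gs : Vec (Code n) m) → Computables (λ v → evalsC (head v) gs (tail v))
    cEvals [] = []c
    cEvals (g ∷ gs) = cEval g ∷c cEvals gs

module EvaluatorCorrectness where
  open import Defs
  open Computability
  open ClockedEvaluator
  open import Data.Nat using (ℕ; zero; suc; _+_; _*_; _∸_; _≤_; _<_; s≤s; _⊔_; pred)
  open import Data.Nat.Properties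
  open import Data.Vec using (Vec; []; _∷_; head; tail; map)
  open import Data.Product using (Σ; _,_; proj₁; proj₂; _×_)
  open import Data.Sum using (inj₁; inj₂)
  open import Relation.Binary.PropositionalEquality
  open import Relation.Nullary using (¬_)
  open import Data.Empty using (⊥-elim)

  eq1-ss : ∀ m → eq1 (suc (suc m)) ≡ 0
  eq1-ss m = nsg-suc (m + 0)

  sg-suc* : ∀ a b → sg (suc a) * b ≡ b
  sg-suc* a b rewrite sg-suc a = +-identityʳ b

  sg*≡suc : ∀ a b y → sg a * b ≡ suc y → Σ ℕ (λ a' → a ≡ suc a') × b ≡ suc y
  sg*≡suc zero b y ()
  sg*≡suc (suc a) b y eq = (a , refl) , trans (sym (sg-suc* a b)) eq

  st0 : ∀ b r → searchStep 0 b r ≡ 0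
  st0 b r = refl
  st10 : ∀ b → searchStep 1 b 0 ≡ 0
  st10 b = refl
  st11 : ∀ b → searchStep 1 b 1 ≡ suc (suc b)
  st11 b rewrite +-identityʳ (b + 2) | +-identityʳ (b + 2) | +-identityʳ (b + 2) | +-identityʳ (b + 2) = trans (+-identityʳ (b + 2)) (+-comm b 2)
  st1ss : ∀ b v → searchStep 1 b (suc (suc v)) ≡ 1
  st1ss b v rewrite sg-suc (suc v) | eq1-ss v = refl
  stss : ∀ m b r → searchStep (suc (suc m)) b r ≡ suc (suc m)
  stss m b r rewrite eq1-ss m = +-identityʳ (suc (suc m))

  -- h k is a halted, nonzero value: the search must go on past k.
  Passes : (ℕ → ℕ) → ℕ → Set
  Passes h k = Σ ℕ λ v → h k ≡ suc (suc v)

  search-passed : ∀ h b → muSearch h b ≡ 1 → ∀ k → k < b → Passes h k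
  search-passed h (suc b) eq k k<b with muSearch h b in e1
  ... | zero = ⊥-elim (case01 eq)
    where case01 : ¬ searchStep 0 b (h b) ≡ 1
          case01 ()
  ... | suc (suc m) = ⊥-elim (case2 (trans (sym (stss m b (h b))) eq))
    where case2 : ¬ suc (suc m) ≡ 1
          case2 ()
  ... | suc zero with h b in e2
  ...   | zero = ⊥-elim (c0 eq)
    where c0 : ¬ searchStep 1 b 0 ≡ 1
          c0 ()
  ...   | suc zero = ⊥-elim (c1' (trans (sym (st11 b)) eq))
    where c1' : ¬ suc (suc b) ≡ 1
          c1' ()
  ...   | suc (suc v) with m≤n⇒m<n∨m≡n (≤-pred k<b)
  ...     | inj₁ lt = search-passed h b e1 k lt
  ...     | inj₂ refl = v , e2

  search-found : ∀ h b m → muSearch h b ≡ suc (suc m) → m < b × h m ≡ 1 × (∀ k → k < m → Passes h k)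
  search-found h zero m ()
  search-found h (suc b) m eq with muSearch h b in e1
  ... | zero = ⊥-elim (c (trans (sym (st0 b (h b))) eq))
    where c : ¬ 0 ≡ suc (suc m)
          c ()
  ... | suc (suc m') with trans (sym (stss m' b (h b))) eq
  ...   | refl with search-found h b m e1
  ...     | lt , p , q = ≤-trans lt (n≤1+n b) , p , q
  search-found h (suc b) m eq | suc zero with h b in e2
  ...   | zero = ⊥-elim (c (trans (sym (st10 b)) eq))
    where c : ¬ 0 ≡ suc (suc m)
          c ()
  ...   | suc (suc v) = ⊥-elim (c (trans (sym (st1ss b v)) eq))
    where c : ¬ 1 ≡ suc (suc m)
          c ()
  ...   | suc zero with trans (sym (st11 b)) eq
  ...     | refl = ≤-refl , e2 , search-passed h b e1

  search-passing : ∀ h m → (∀ k → k < m → Passes h k) → ∀ b → b ≤ m → muSearch h b ≡ 1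
  search-passing h m q zero _ = refl
  search-passing h m q (suc b) le with q b le
  ... | v , e rewrite search-passing h m q b (≤-trans (n≤1+n b) le) | e = st1ss b v

  search-finds : ∀ h m → h m ≡ 1 → (∀ k → k < m → Passes h k) → ∀ b → m < b → muSearch h b ≡ suc (suc m)
  search-finds h m hm q (suc b) lt with m≤n⇒m<n∨m≡n (≤-pred lt)
  ... | inj₁ lt' rewrite search-finds h m hm q b lt' = stss m b (h b)
  ... | inj₂ refl rewrite search-passing h m q m ≤-refl | hm = st11 m

  ∸1≡suc : ∀ a y → a ∸ 1 ≡ suc y → a ≡ suc (suc y)
  ∸1≡suc (suc (suc a)) y refl = refl

  suc≢0 : ∀ {a} → ¬ suc a ≡ 0
  suc≢0 ()

  prodNZ : ∀ a b → ¬ a * b ≡ 0 → ¬ b ≡ 0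
  prodNZ a b nz refl = nz (*-zeroʳ a)

  mutual
    sound : ∀ {n} t (e : Code n) xs y → evalC t e xs ≡ suc y → e ⟦ xs ⟧⇓ y
    sound t zer xs y refl = ev-zer
    sound t succ (x ∷ []) y refl = ev-succ
    sound t (proj i) xs y refl = ev-proj
    sound t (comp f gs) xs y eq with sg*≡suc (prodV (evalsC t gs xs)) _ y eq
    ... | (a , pa) , ef = ev-comp (soundV t gs xs (λ z → c (trans (sym pa) z))) (sound t f _ y ef)
      where c : ¬ suc a ≡ 0
            c ()
    sound t (prec f g) (k ∷ xs) y eq = soundP t f g k xs y eq
    sound t (mu f) xs y eq with search-found (λ b → evalC t f (b ∷ xs)) (suc t) y (∸1≡suc _ y eq)
    ... | _ , hy , q = ev-mu (sound t f (y ∷ xs) 0 hy) λ k lt → proj₁ (q k lt) , sound t f (k ∷ xs) _ (proj₂ (q k lt))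

    soundP : ∀ {n} t (f : Code n) g k xs y → precE (evalC t f) (evalC t g) k xs ≡ suc y → prec f g ⟦ k ∷ xs ⟧⇓ y
    soundP t f g zero xs y eq = ev-prec0 (sound t f xs y eq)
    soundP t f g (suc k) xs y eq with sg*≡suc (precE (evalC t f) (evalC t g) k xs) _ y eq
    ... | (r , pr) , eb = ev-precS (soundP t f g k xs r pr)
                                   (sound t g _ y (subst (λ z → evalC t g (k ∷ pred z ∷ xs) ≡ suc y) pr eb))

    soundV : ∀ {n m} t (gs : Vec (Code n) m) xs → ¬ prodV (evalsC t gs xs) ≡ 0 → gs ⟦ xs ⟧⇓* map pred (evalsC t gs xs)
    soundV t [] xs nz = ev-[]
    soundV t (g ∷ gs) xs nz with evalC t g xs in eq
    ... | zero = ⊥-elim (nz refl)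
    ... | suc r = ev-∷ (sound t g xs r eq) (soundV t gs xs (prodNZ (suc r) _ nz))

  mutual
    mono : ∀ {n} t t' (e : Code n) xs y → t ≤ t' → evalC t e xs ≡ suc y → evalC t' e xs ≡ suc y
    mono t t' zer xs y le eq = eq
    mono t t' succ (x ∷ []) y le eq = eq
    mono t t' (proj i) xs y le eq = eq
    mono t t' (comp f gs) xs y le eq with sg*≡suc (prodV (evalsC t gs xs)) _ y eq
    ... | (a , pa) , ef rewrite monoV t t' gs xs le (λ z → suc≢0 (trans (sym pa) z)) =
          trans (cong (sg (prodV (evalsC t gs xs)) *_) (trans (mono t t' f _ y le ef) (sym ef))) eq
    mono t t' (prec f g) (k ∷ xs) y le eq = monoP t t' f g k xs y le eq
    mono t t' (mu f) xs y le eq with search-found (λ b → evalC t f (b ∷ xs)) (suc t) y (∸1≡suc _ y eq)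
    ... | lt , hy , q = cong (_∸ 1) (search-finds (λ b → evalC t' f (b ∷ xs)) y (mono t t' f _ 0 le hy)
           (λ k kl → proj₁ (q k kl) , mono t t' f _ _ le (proj₂ (q k kl))) (suc t') (≤-trans lt (s≤s le)))

    monoP : ∀ {n} t t' (f : Code n) g k xs y → t ≤ t' → precE (evalC t f) (evalC t g) k xs ≡ suc y →
            precE (evalC t' f) (evalC t' g) k xs ≡ suc y
    monoP t t' f g zero xs y le eq = mono t t' f xs y le eq
    monoP t t' f g (suc k) xs y le eq with sg*≡suc (precE (evalC t f) (evalC t g) k xs) _ y eq
    ... | (r , pr) , eb rewrite monoP t t' f g k xs r le pr =
          trans (sg-suc* r _) (mono t t' g _ y le (subst (λ z → evalC t g (k ∷ pred z ∷ xs) ≡ suc y) pr eb))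

    monoV : ∀ {n m} t t' (gs : Vec (Code n) m) xs → t ≤ t' → ¬ prodV (evalsC t gs xs) ≡ 0 → evalsC t' gs xs ≡ evalsC t gs xs
    monoV t t' [] xs le nz = refl
    monoV t t' (g ∷ gs) xs le nz with evalC t g xs in eq
    ... | zero = ⊥-elim (nz refl)
    ... | suc r = cong₂ _∷_ (mono t t' g xs r le eq) (monoV t t' gs xs le (prodNZ (suc r) _ nz))

  monoVs : ∀ {n m} t t' (gs : Vec (Code n) m) xs ys → t ≤ t' → evalsC t gs xs ≡ map suc ys → evalsC t' gs xs ≡ map suc ys
  monoVs t t' [] xs [] le eq = refl
  monoVs t t' (g ∷ gs) xs (y ∷ ys) le eq =
    cong₂ _∷_ (mono t t' g xs y le (cong head eq)) (monoVs t t' gs xs ys le (cong tail eq))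

  prodSuc : ∀ {m} (ys : Vec ℕ m) → Σ ℕ λ p → prodV (map suc ys) ≡ suc p
  prodSuc [] = 0 , refl
  prodSuc (y ∷ ys) with prodSuc ys
  ... | p , e rewrite e = _ , refl

  mapPS : ∀ {m} (ys : Vec ℕ m) → map pred (map suc ys) ≡ ys
  mapPS [] = refl
  mapPS (y ∷ ys) = cong (y ∷_) (mapPS ys)

  uniformClock : ∀ {n} (f : Code (suc n)) xs m →
    (∀ k → k < m → Σ ℕ λ t → Passes (λ b → evalC t f (b ∷ xs)) k) →
    Σ ℕ λ T → ∀ k → k < m → Passes (λ b → evalC T f (b ∷ xs)) k
  uniformClock f xs zero h = 0 , λ k ()
  uniformClock f xs (suc j) h with uniformClock f xs j (λ k lt → h k (≤-trans lt (n≤1+n j))) | h j ≤-refl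
  ... | T , q | tj , vj , ej = T ⊔ tj , probe
    where
      probe : ∀ k → k < suc j → Passes (λ b → evalC (T ⊔ tj) f (b ∷ xs)) k
      probe k lt with m≤n⇒m<n∨m≡n (≤-pred lt)
      ... | inj₁ lt' = proj₁ (q k lt') , mono T (T ⊔ tj) f _ _ (m≤m⊔n T tj) (proj₂ (q k lt'))
      ... | inj₂ refl = vj , mono tj (T ⊔ tj) f _ _ (m≤n⊔m T tj) ej

  mutual
    complete : ∀ {n} {e : Code n} {xs y} → e ⟦ xs ⟧⇓ y → Σ ℕ λ t → evalC t e xs ≡ suc y
    complete ev-zer = 0 , refl
    complete ev-succ = 0 , refl
    complete ev-proj = 0 , refl
    complete (ev-comp {f = f} {gs = gs} {xs = xs} {ys} {y} ds d) with completeV ds | complete d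
    ... | t1 , e1 | t2 , e2 with prodSuc ys
    ...   | p , ep = t1 ⊔ t2 , goal
      where
        goal : evalC (t1 ⊔ t2) (comp f gs) xs ≡ suc y
        goal rewrite monoVs t1 (t1 ⊔ t2) gs xs ys (m≤m⊔n t1 t2) e1 | mapPS ys | ep
                   | mono t2 (t1 ⊔ t2) f ys y (m≤n⊔m t1 t2) e2 = sg-suc* p (suc y)
    complete (ev-prec0 d) = complete d
    complete (ev-precS {f = f} {g} {k} {xs} {r} {y} d d') with complete d | complete d'
    ... | t1 , e1 | t2 , e2 = t1 ⊔ t2 , goal
      where
        goal : evalC (t1 ⊔ t2) (prec f g) (suc k ∷ xs) ≡ suc y
        goal rewrite mono t1 (t1 ⊔ t2) (prec f g) (k ∷ xs) r (m≤m⊔n t1 t2) e1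
                   | mono t2 (t1 ⊔ t2) g (k ∷ r ∷ xs) y (m≤n⊔m t1 t2) e2 = sg-suc* r (suc y)
    complete (ev-mu {f = f} {xs} {m} d h) with complete d
        | uniformClock f xs m (λ k lt → proj₁ (complete (proj₂ (h k lt))) , proj₁ (h k lt) , proj₂ (complete (proj₂ (h k lt))))
    ... | t0 , e0 | T , q = t , cong (_∸ 1) (search-finds (λ b → evalC t f (b ∷ xs)) m (mono t0 t f _ 0 l0 e0)
                     (λ k kl → proj₁ (q k kl) , mono T t f _ _ lT (proj₂ (q k kl))) (suc t) (s≤s lm))
      where
        t = (t0 ⊔ T) ⊔ m
        l0 : t0 ≤ t
        l0 = ≤-trans (m≤m⊔n t0 T) (m≤m⊔n _ m)
        lT : T ≤ t
        lT = ≤-trans (m≤n⊔m t0 T) (m≤m⊔n _ m)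
        lm : m ≤ t
        lm = m≤n⊔m _ m

    completeV : ∀ {n m} {gs : Vec (Code n) m} {xs ys} → gs ⟦ xs ⟧⇓* ys → Σ ℕ λ t → evalsC t gs xs ≡ map suc ys
    completeV ev-[] = 0 , refl
    completeV (ev-∷ {g = g} {gs} {xs} {y} {ys} d ds) with complete d | completeV ds
    ... | t1 , e1 | t2 , e2 = t1 ⊔ t2 , cong₂ _∷_ (mono t1 (t1 ⊔ t2) g xs y (m≤m⊔n t1 t2) e1)
                                                (monoVs t2 (t1 ⊔ t2) gs xs ys (m≤n⊔m t1 t2) e2)

  det : ∀ {n} {e : Code n} {xs a b} → e ⟦ xs ⟧⇓ a → e ⟦ xs ⟧⇓ b → a ≡ b
  det {e = e} {xs} d1 d2 with complete d1 | complete d2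
  ... | t1 , e1 | t2 , e2 = cong pred (trans (sym (mono t1 (t1 ⊔ t2) e xs _ (m≤m⊔n t1 t2) e1))
                                             (mono t2 (t1 ⊔ t2) e xs _ (m≤n⊔m t1 t2) e2))

  mu-root : ∀ {n} {f : Fn (suc n)} (c : Computable f) {xs y} → mu (proj₁ c) ⟦ xs ⟧⇓ y → f (y ∷ xs) ≡ 0
  mu-root c (ev-mu d _) = det (proj₂ c _) d

module WordCoding where
  open import Defs
  open Computability
  open import Data.Nat using (ℕ; zero; suc; _+_; _*_; _∸_; _≤_; _<_; z≤n; s≤s; pred)
  open import Data.Nat.Properties
  open import Data.Nat.Tactic.RingSolver
  open import Data.Bool using (Bool; true; false)
  open import Data.Fin using (zero; suc)
  open import Data.Vec using ([]; _∷_)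
  open import Data.List using ([]; _∷_; _++_; length; drop)
  open import Data.Product using (Σ; _,_; proj₁; proj₂; _×_)
  open import Data.Sum using (_⊎_; inj₁; inj₂)
  open import Data.Nat.DivMod using (_%_; _/_; [m+n]%n≡m%n; m/n≡1+[m∸n]/n)
  open import Data.Integer using (+_; -[1+_])
  open import Relation.Binary.PropositionalEquality
  open import Relation.Nullary using (yes; no)
  open import Relation.Binary using (tri<; tri≈; tri>)
  open import Data.Empty using (⊥; ⊥-elim)
  open import Data.Bool.Properties using (¬-not)

  -- Parity and halving, defined by recursion so that they are visibly computable.
  par : ℕ → ℕ
  par zero = 0
  par (suc n) = nsg (par n)

  half : ℕ → ℕ
  half zero = 0
  half (suc n) = half n + par n

  par-half : ∀ m → (par m ≡ 0 × m ≡ 2 * half m) ⊎ (par m ≡ 1 × m ≡ suc (2 * half m))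
  par-half zero = inj₁ (refl , refl)
  par-half (suc m) with par-half m
  ... | inj₁ (p , e) rewrite p = inj₂ (refl , trans (cong suc e) (cong (λ z → suc (2 * z)) (sym (+-identityʳ (half m)))))
  ... | inj₂ (p , e) rewrite p = inj₁ (refl , trans (cong suc e) (lem (half m)))
    where lem : ∀ h → suc (suc (2 * h)) ≡ 2 * (h + 1)
          lem = solve-∀

  lem2s : ∀ e → 2 * suc e ≡ suc (suc (2 * e))
  lem2s = solve-∀

  par-even : ∀ e → par (2 * e) ≡ 0 × half (2 * e) ≡ e
  par-even zero = refl , refl
  par-even (suc e) with par-even e
  ... | p , h = subst (λ z → par z ≡ 0 × half z ≡ suc e) (sym (lem2s e)) g
    where g : par (suc (suc (2 * e))) ≡ 0 × half (suc (suc (2 * e))) ≡ suc e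
          g rewrite p | h = refl , trans (cong (_+ 1) (+-identityʳ e)) (+-comm e 1)

  par-odd : ∀ e → par (suc (2 * e)) ≡ 1 × half (suc (2 * e)) ≡ e
  par-odd e with par-even e
  ... | p , h rewrite p | h = refl , +-identityʳ e

  half≤ : ∀ m → half m ≤ m
  half≤ m with par-half m
  ... | inj₁ (_ , e) = ≤-trans (m≤m+n (half m) (half m + 0)) (≤-reflexive (sym e))
  ... | inj₂ (_ , e) = ≤-trans (m≤m+n (half m) (suc (half m + 0))) (≤-reflexive (trans (+-suc (half m) (half m + 0)) (sym e)))

  -- Decoding inverts encode; the fuel f ≥ n bounds the number of letters.
  n2b : ℕ → Bool
  n2b zero = false
  n2b (suc _) = true

  b2n : Bool → ℕ
  b2n false = 0
  b2n true = 1

  decodeF : ℕ → ℕ → Word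
  decodeF zero n = []
  decodeF (suc f) zero = []
  decodeF (suc f) (suc m) = n2b (par m) ∷ decodeF f (half m)

  decode : ℕ → Word
  decode n = decodeF n n

  ≤double : ∀ e → e ≤ 2 * e
  ≤double e = m≤m+n e (e + 0)

  decF-enc : ∀ f w → encode w ≤ f → decodeF f (encode w) ≡ w
  decF-enc f [] le with f
  ... | zero = refl
  ... | suc _ = refl
  decF-enc (suc f) (false ∷ w) (s≤s le) with par-even (encode w)
  ... | p , h rewrite p | h = cong (false ∷_) (decF-enc f w (≤-trans (≤double (encode w)) le))
  decF-enc (suc f) (true ∷ w) (s≤s le) with par-odd (encode w)
  ... | p , h rewrite p | h = cong (true ∷_) (decF-enc f w (≤-trans (≤-trans (≤double (encode w)) (n≤1+n _)) le))

  dec-enc : ∀ w → decode (encode w) ≡ w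
  dec-enc w = decF-enc (encode w) w ≤-refl

  enc-decF : ∀ f n → n ≤ f → encode (decodeF f n) ≡ n
  enc-decF f zero le with f
  ... | zero = refl
  ... | suc _ = refl
  enc-decF (suc f) (suc m) (s≤s le) with par-half m
  ... | inj₁ (p , e) rewrite p | enc-decF f (half m) (≤-trans (half≤ m) le) = cong suc (sym e)
  ... | inj₂ (p , e) rewrite p | enc-decF f (half m) (≤-trans (half≤ m) le) = cong suc (sym e)

  enc-dec : ∀ n → encode (decode n) ≡ n
  enc-dec n = enc-decF n n ≤-refl

  -- The length of a coded word: the least k with code + 2 ≤ 2^(k+1).
  lenN : ℕ → ℕ
  lenN x = length (decode x)

  pw-mono : ∀ {a b} → a ≤ b → pw a ≤ pw b
  pw-mono {zero} {zero} _ = ≤-refl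
  pw-mono {zero} {suc b} _ = ≤-trans (pw-mono {0} {b} z≤n) (m≤m+n (pw b) (pw b))
  pw-mono {suc a} {suc b} (s≤s le) = +-mono-≤ (pw-mono le) (pw-mono le)

  pw-lo : ∀ w → pw (length w) ≤ suc (encode w)
  pw-lo [] = ≤-refl
  pw-lo (false ∷ w) = ≤-trans (+-mono-≤ (pw-lo w) (pw-lo w)) (≤-reflexive (lem (encode w)))
    where lem : ∀ e → suc e + suc e ≡ suc (suc (e + (e + 0)))
          lem = solve-∀
  pw-lo (true ∷ w) = ≤-trans (+-mono-≤ (pw-lo w) (pw-lo w)) (≤-trans (≤-reflexive (lem (encode w))) (n≤1+n _))
    where lem : ∀ e → suc e + suc e ≡ suc (suc (e + (e + 0)))
          lem = solve-∀

  pw-hi : ∀ w → encode w + 2 ≤ pw (suc (length w))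
  pw-hi [] = ≤-refl
  pw-hi (false ∷ w) = ≤-trans (≤-trans (n≤1+n _) (≤-reflexive (lem (encode w)))) (+-mono-≤ (pw-hi w) (pw-hi w))
    where lem : ∀ e → suc (suc (e + (e + 0)) + 2) ≡ (e + 2) + (e + 2)
          lem = solve-∀
  pw-hi (true ∷ w) = ≤-trans (≤-reflexive (lem (encode w))) (+-mono-≤ (pw-hi w) (pw-hi w))
    where lem : ∀ e → suc (suc (e + (e + 0))) + 2 ≡ (e + 2) + (e + 2)
          lem = solve-∀

  lenTest : ℕ → ℕ → ℕ
  lenTest k x = (x + 2) ∸ pw (suc k)

  cLenTest : Computable₂ lenTest
  cLenTest = cExt (ap2 cMonus (ap2 cAdd (cP (suc zero)) (cS $1 cS $1 cZ)) (cPw $1 cS $1 cP zero)) λ { (k ∷ x ∷ []) → refl }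

  lenRoot : ∀ x → LeastRoot (λ k → lenTest k x) (lenN x)
  lenRoot x = z , nz
    where
      w = decode x
      ex : encode w ≡ x
      ex = enc-dec x
      z : lenTest (lenN x) x ≡ 0
      z = m≤n⇒m∸n≡0 (subst (λ y → y + 2 ≤ pw (suc (length w))) ex (pw-hi w))
      nz : ∀ k → k < lenN x → NZ (lenTest k x)
      nz k lt eq = 1+n≰n (subst (_≤ suc x) (+-comm x 2) (≤-trans (m∸n≡0⇒m≤n eq)
                     (≤-trans (pw-mono lt) (subst (λ y → pw (length w) ≤ suc y) ex (pw-lo w)))))

  cLen : Computable₁ lenN
  cLen = mu (proj₁ cLenTest) , λ { (x ∷ []) → muOK cLenTest (x ∷ []) (lenN x) (lenRoot x) }

  -- Concatenation on codes: code (u w) = code u + 2^|u| · code w.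
  catN : ℕ → ℕ → ℕ
  catN x y = x + pw (lenN x) * y

  cCat : Computable₂ catN
  cCat = cExt (ap2 cAdd (cP zero) (ap2 cMul (cPw $1 cLen $1 cP zero) (cP (suc zero)))) λ { (x ∷ y ∷ []) → refl }

  enc++' : ∀ u w → encode (u ++ w) ≡ encode u + pw (length u) * encode w
  enc++' [] w = sym (+-identityʳ (encode w))
  enc++' (false ∷ u) w rewrite enc++' u w = lem (encode u) (pw (length u)) (encode w)
    where lem : ∀ a p e → suc (2 * (a + p * e)) ≡ suc (2 * a) + (p + p) * e
          lem = solve-∀
  enc++' (true ∷ u) w rewrite enc++' u w = lem (encode u) (pw (length u)) (encode w)
    where lem : ∀ a p e → suc (suc (2 * (a + p * e))) ≡ suc (suc (2 * a)) + (p + p) * e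
          lem = solve-∀

  enc++ : ∀ u w → encode (u ++ w) ≡ catN (encode u) (encode w)
  enc++ u w rewrite dec-enc u = enc++' u w

  -- Reading letter j of a coded word: drop j letters (halving) and take the parity.
  tlN : ℕ → ℕ
  tlN x = half (pred x)

  hdN : ℕ → ℕ
  hdN x = par (pred x)

  drN : ℕ → ℕ → ℕ
  drN zero x = x
  drN (suc j) x = tlN (drN j x)

  nth : Word → ℕ → Bool
  nth [] j = false
  nth (b ∷ w) zero = b
  nth (b ∷ w) (suc j) = nth w j

  tl-enc : ∀ w → tlN (encode w) ≡ encode (drop 1 w)
  tl-enc [] = refl
  tl-enc (false ∷ w) = proj₂ (par-even (encode w))
  tl-enc (true ∷ w) = proj₂ (par-odd (encode w))

  hd-enc : ∀ b w → hdN (encode (b ∷ w)) ≡ b2n b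
  hd-enc false w = proj₁ (par-even (encode w))
  hd-enc true w = proj₁ (par-odd (encode w))

  dropS : ∀ j (w : Word) → drop (suc j) w ≡ drop 1 (drop j w)
  dropS zero w = refl
  dropS (suc j) [] = refl
  dropS (suc j) (b ∷ w) = dropS j w

  dr-enc : ∀ j w → drN j (encode w) ≡ encode (drop j w)
  dr-enc zero w = refl
  dr-enc (suc j) w rewrite dr-enc j w | dropS j w = tl-enc (drop j w)

  nth-drop : ∀ j w → hdN (encode (drop j w)) ≡ b2n (nth w j)
  nth-drop zero [] = refl
  nth-drop (suc j) [] = refl
  nth-drop zero (b ∷ w) = hd-enc b w
  nth-drop (suc j) (b ∷ w) = nth-drop j w

  bitN : ℕ → ℕ → ℕ
  bitN x j = hdN (drN j x)

  bit-enc : ∀ w j → bitN (encode w) j ≡ b2n (nth w j)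
  bit-enc w j rewrite dr-enc j w = nth-drop j w

  cPar : Computable₁ par
  cPar = cExt (cR {n = 0} cZ (cNsg $1 cP (suc zero))) λ { (k ∷ []) → go k }
    where go : ∀ k → recN (λ _ → 0) (λ v → nsg (Data.Vec.lookup v (suc zero))) k [] ≡ par k
          go zero = refl
          go (suc k) = cong nsg (go k)

  cHalf : Computable₁ half
  cHalf = cExt (cR {n = 0} cZ (ap2 cAdd (cP (suc zero)) (cPar $1 cP zero))) λ { (k ∷ []) → go k }
    where go : ∀ k → recN (λ _ → 0) (λ v → Data.Vec.lookup v (suc zero) + par (Data.Vec.lookup v zero)) k [] ≡ half k
          go zero = refl
          go (suc k) = cong (_+ par k) (go k)

  cBit : Computable₂ bitN
  cBit = cExt (ap2 letterAt (cP (suc zero)) (cP zero)) λ { (x ∷ j ∷ []) → refl }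
    where
      letterAt : Computable (binary (λ j x → hdN (drN j x)))
      letterAt = cExt (cPar $1 cPred $1 cR (cP zero) (cHalf $1 cPred $1 cP (suc zero))) λ { (j ∷ x ∷ []) → cong (λ z → par (pred z)) (go j x) }
        where go : ∀ j x → recN (λ v → Data.Vec.lookup v zero) (λ v → half (pred (Data.Vec.lookup v (suc zero)))) j (x ∷ []) ≡ drN j x
              go zero x = refl
              go (suc j) x = cong (λ z → half (pred z)) (go j x)

  -- The sweep m ↦ m - ⌊√m⌋² runs through 0, 0 1, 0 1 2, ... and so takes every value
  -- at arbitrarily large arguments; it turns a single enumeration into one in which
  -- each item recurs infinitely often.
  sq : ℕ → ℕ
  sq r = r * r

  isq : ℕ → ℕ
  isq zero = 0
  isq (suc m) = isq m + nsg (sq (suc (isq m)) ∸ suc m)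

  sweep : ℕ → ℕ
  sweep m = m ∸ sq (isq m)

  cSq : Computable₁ sq
  cSq = cExt (ap2 cMul (cP zero) (cP zero)) λ { (x ∷ []) → refl }

  cIsq : Computable₁ isq
  cIsq = cExt (cR {n = 0} cZ (ap2 cAdd (cP (suc zero)) (cNsg $1 ap2 cMonus (cSq $1 cS $1 cP (suc zero)) (cS $1 cP zero))))
              λ { (k ∷ []) → go k }
    where go : ∀ k → recN (λ _ → 0) (λ v → Data.Vec.lookup v (suc zero) + nsg (sq (suc (Data.Vec.lookup v (suc zero))) ∸ suc (Data.Vec.lookup v zero))) k [] ≡ isq k
          go zero = refl
          go (suc k) rewrite go k = refl

  cSweep : Computable₁ sweep
  cSweep = cExt (ap2 cMonus (cP zero) (cSq $1 cIsq $1 cP zero)) λ { (x ∷ []) → refl }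

  sq< : ∀ r → sq r < sq (suc r)
  sq< r = s≤s (≤-trans (m≤m+n (sq r) (2 * r)) (≤-reflexive (lem r)))
    where lem : ∀ r → r * r + 2 * r ≡ r + r * suc r
          lem = solve-∀

  sq-mono : ∀ {a b} → a ≤ b → sq a ≤ sq b
  sq-mono le = *-mono-≤ le le

  nsgpos : ∀ a b → b < a → nsg (a ∸ b) ≡ 0
  nsgpos (suc a) zero _ = nsg-suc a
  nsgpos (suc a) (suc b) (s≤s lt) = nsgpos a b lt

  isq-spec : ∀ m → sq (isq m) ≤ m × m < sq (suc (isq m))
  isq-spec zero = z≤n , s≤s z≤n
  isq-spec (suc m) with isq-spec m
  ... | lo , hi with sq (suc (isq m)) ≤? suc m
  ...   | yes le = subst (λ z → sq z ≤ suc m × suc m < sq (suc z)) (sym eqv) (le , <-≤-trans (s≤s hi) (sq< (suc (isq m))))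
    where eqv : isq (suc m) ≡ suc (isq m)
          eqv rewrite m≤n⇒m∸n≡0 le = +-comm (isq m) 1
  ...   | no nle = subst (λ z → sq z ≤ suc m × suc m < sq (suc z)) (sym eqv) (≤-trans lo (n≤1+n m) , ≰⇒> nle)
    where eqv : isq (suc m) ≡ isq m
          eqv rewrite nsgpos (sq (suc (isq m))) (suc m) (≰⇒> nle) = +-identityʳ (isq m)

  isq-uniq : ∀ m r → sq r ≤ m → m < sq (suc r) → isq m ≡ r
  isq-uniq m r lo hi with isq-spec m | <-cmp (isq m) r
  ... | lo' , hi' | tri< a _ _ = ⊥-elim (<⇒≱ hi' (≤-trans (sq-mono a) lo))
  ... | lo' , hi' | tri≈ _ b _ = b
  ... | lo' , hi' | tri> _ _ c = ⊥-elim (<⇒≱ hi (≤-trans (sq-mono c) lo'))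

  r≤sq : ∀ r → r ≤ sq r
  r≤sq zero = z≤n
  r≤sq (suc r) = m≤m+n (suc r) (r * suc r)

  sweep-hits : ∀ c t → Σ ℕ λ m → t ≤ m × sweep m ≡ c
  sweep-hits c t = sq r + c , ≤-trans (m≤n+m t c) (≤-trans (r≤sq r) (m≤m+n (sq r) c)) , eqK
    where
      r = c + t
      hi : sq r + c < sq (suc r)
      hi = s≤s (≤-trans (+-monoʳ-≤ (sq r) (≤-trans (m≤m+n c t) (m≤m+n r (r + 0)))) (≤-reflexive (lem r)))
        where lem : ∀ r → r * r + 2 * r ≡ r + r * suc r
              lem = solve-∀
      eqK : sweep (sq r + c) ≡ c
      eqK rewrite isq-uniq (sq r + c) r (m≤m+n (sq r) c) hi = m+n∸m≡n (sq r) c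

  len≤enc : ∀ w → length w ≤ encode w
  len≤enc [] = z≤n
  len≤enc (false ∷ w) = s≤s (≤-trans (len≤enc w) (m≤m+n _ _))
  len≤enc (true ∷ w) = s≤s (≤-trans (≤-trans (len≤enc w) (m≤m+n _ _)) (n≤1+n _))

  par01 : ∀ n → par n ≡ 0 ⊎ par n ≡ 1
  par01 n with par-half n
  ... | inj₁ (p , _) = inj₁ p
  ... | inj₂ (p , _) = inj₂ p

  mod2 : ∀ n → n % 2 ≡ par n
  mod2 zero = refl
  mod2 (suc zero) = refl
  mod2 (suc (suc n)) = trans (cong (_% 2) (+-comm 2 n)) (trans ([m+n]%n≡m%n n 2) (trans (mod2 n) (lem (par01 n))))
    where lem : par n ≡ 0 ⊎ par n ≡ 1 → par n ≡ nsg (nsg (par n))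
          lem (inj₁ e) rewrite e = refl
          lem (inj₂ e) rewrite e = refl

  div2 : ∀ n → n / 2 ≡ half n
  div2 zero = refl
  div2 (suc zero) = refl
  div2 (suc (suc n)) = trans (m/n≡1+[m∸n]/n {suc (suc n)} {2} (s≤s (s≤s z≤n))) (trans (cong suc (div2 n)) (lem (par01 n)))
    where lem : par n ≡ 0 ⊎ par n ≡ 1 → suc (half n) ≡ half n + par n + nsg (par n)
          lem (inj₁ e) rewrite e = trans (+-comm 1 (half n)) (cong (_+ 1) (sym (+-identityʳ (half n))))
          lem (inj₂ e) rewrite e = trans (+-comm 1 (half n)) (sym (+-identityʳ (half n + 1)))

  wb : BiWord → ℕ → ℕ → Bool
  wb ξ zero i = ξ (+ i)
  wb ξ (suc _) zero = false
  wb ξ (suc _) (suc j) = ξ -[1+ j ]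

  wordBit-eq : ∀ ξ n → wordBit ξ n ≡ wb ξ (par n) (half n)
  wordBit-eq ξ n with n % 2 | mod2 n | n / 2 | div2 n
  ... | _ | refl | _ | refl with par n
  ...   | zero = refl
  ...   | suc _ with half n
  ...     | zero = refl
  ...     | suc j = refl

  pe : ∀ j → par (j + j) ≡ 0 × half (j + j) ≡ j
  pe j = subst (λ z → par z ≡ 0 × half z ≡ j) (cong (λ z → j + z) (+-identityʳ j)) (par-even j)

  indicator→recursive : (P : ℕ → Bool) → Computable₁ (λ n → b2n (P n)) → RecursiveSet (λ n → P n ≡ true)
  indicator→recursive P (e , ok) = e , λ n →
    (λ Pn → subst (e ⟦ n ∷ [] ⟧⇓_) (cong b2n Pn) (ok (n ∷ [])))
    , (λ ¬Pn → subst (e ⟦ n ∷ [] ⟧⇓_) (cong b2n (¬-not ¬Pn)) (ok (n ∷ [])))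

  recursive→indicator : (P : ℕ → Bool) → RecursiveSet (λ n → P n ≡ true) → Computable₁ (λ n → b2n (P n))
  recursive→indicator P (e , dec) = e , λ { (n ∷ []) → decided n }
    where decided : ∀ n → e ⟦ n ∷ [] ⟧⇓ b2n (P n)
          decided n with P n in Pn
          ... | true = proj₁ (dec n) Pn
          ... | false = proj₂ (dec n) (λ Pn≡true → true≢false (trans (sym Pn≡true) Pn))
            where true≢false : true ≡ false → ⊥
                  true≢false ()

module Windows where
  open import Defs
  open WordCoding using (nth)
  open import Data.Nat as N using (ℕ; zero; suc; _+_; _∸_; _≤_; _<_; z≤n; s≤s)
  open import Data.Nat.Properties
  open import Data.Integer as Z using (+_; -[1+_]; _⊖_; ∣_∣)
  import Data.Integer.Properties as ZP
  open import Data.Bool using (Bool; true)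
  open import Data.List using ([]; _∷_; _++_; length; drop; take)
  open import Data.List.Properties using (length-++; length-++-≤ˡ; length-++-≤ʳ; ++-identityʳ; take++drop≡id; ++-monoid)
  open import Data.Product using (Σ; _,_; proj₁; proj₂; _×_)
  open import Relation.Binary.PropositionalEquality
  open import Relation.Nullary using (yes; no)
  open import Data.Empty using (⊥-elim)
  open import Function.Bundles using (mk⇔)
  open import Data.Nat.Tactic.RingSolver using (solve-∀)
  import Data.Integer.Tactic.RingSolver as ZR
  open import Algebra.Solver.Monoid (++-monoid Bool) using (solve; _⊕_; _⊜_)

  -- Given a factorial L, a non-empty word
  -- w0 ∈ L, a choice function cv with u (cv u w) w ∈ L, and a list ℓ₀ ℓ₁ ... of
  -- words of L in which every word of L occurs infinitely often, define
  --   W₀ = w0,   W_{n+1} = A v₁ A v₂ A   with   A = W_n v ℓ_n v' W_n,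
  -- the connectors v, v', v₁, v₂ chosen by cv so that every W_n lies in L.
  -- W_n occurs in W_{n+1} at offset |A v₁|; recording the accumulated offset p_n
  -- of an "origin" inside W_n, all W_n are consistent windows of one bi-infinite
  -- word ξ, with ξ(i) = W_n(p_n + i).  Factors of ξ are factors of some W_n (so in
  -- L), every ℓ_n occurs in W_{n+1} (so F(ξ) = L), and since ℓ_n occurs both left
  -- and right of the window W_n, whose margins grow with n, ξ is recurrent.
  -- The parameters are abstract so that the same construction yields a recursive
  -- ξ when cv and the enumeration are computable (REToRecursiveWord).

  nth-app-r : ∀ (P Q : Word) a → nth (P ++ Q) (length P + a) ≡ nth Q a
  nth-app-r [] Q a = refl
  nth-app-r (x ∷ P) Q a = nth-app-r P Q a

  nth-app-l : ∀ (P Q : Word) a → a < length P → nth (P ++ Q) a ≡ nth P a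
  nth-app-l (x ∷ P) Q zero _ = refl
  nth-app-l (x ∷ P) Q (suc a) (s≤s lt) = nth-app-l P Q a lt

  drop-nth : ∀ (w : Word) a → a < length w → drop a w ≡ nth w a ∷ drop (suc a) w
  drop-nth (x ∷ w) zero _ = refl
  drop-nth (x ∷ w) (suc a) (s≤s lt) = drop-nth w a lt

  take-occurrence : ∀ (P x Q : Word) → take (length x) (drop (length P) (P ++ (x ++ Q))) ≡ x
  take-occurrence [] [] Q = refl
  take-occurrence [] (b ∷ x) Q = cong (b ∷_) (take-occurrence [] x Q)
  take-occurrence (y ∷ P) x Q = take-occurrence P x Q

  len3 : ∀ (P x Q : Word) → length (P ++ (x ++ Q)) ≡ length P + (length x + length Q)
  len3 P x Q rewrite length-++ P {x ++ Q} | length-++ x {Q} = refl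

  factor-split : ∀ (w : Word) a k → w ≡ take a w ++ (take k (drop a w) ++ drop k (drop a w))
  factor-split w a k = sym (trans (cong (take a w ++_) (take++drop≡id k (drop a w))) (take++drop≡id a w))

  -- Positions: integer offsets a ⊖ p of a position a in a window with origin p.
  ⊖+ : ∀ a b k → (a ⊖ b) Z.+ (+ k) ≡ (a + k) ⊖ b
  ⊖+ a b k rewrite sym (ZP.m-n≡m⊖n a b) | sym (ZP.m-n≡m⊖n (a + k) b) | ZP.pos-+ a k = lem (+ a) (+ b) (+ k)
    where lem : ∀ x y z → x Z.+ Z.- y Z.+ z ≡ x Z.+ z Z.+ Z.- y
          lem = ZR.solve-∀

  ⊖+1 : ∀ a b → (a ⊖ b) Z.+ Z.1ℤ ≡ suc a ⊖ b
  ⊖+1 a b = trans (⊖+ a b 1) (cong (_⊖ b) (+-comm a 1))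

  ⊖-cancel : ∀ c a b → (c + a) ⊖ (c + b) ≡ a ⊖ b
  ⊖-cancel zero a b = refl
  ⊖-cancel (suc c) a b = trans (ZP.[1+m]⊖[1+n]≡m⊖n (c + a) (c + b)) (⊖-cancel c a b)

  le-pos : ∀ i d → ∣ i ∣ ≤ d → i Z.≤ + d
  le-pos (+ x) d le = Z.+≤+ le
  le-pos -[1+ x ] d le = Z.-≤+

  le-neg : ∀ i d → ∣ i ∣ ≤ d → Z.- (+ d) Z.≤ i Z.+ Z.1ℤ
  le-neg (+ zero) zero le = Z.+≤+ z≤n
  le-neg (+ x) (suc d) le = Z.-≤+
  le-neg -[1+ zero ] (suc d) le = Z.-≤+
  le-neg -[1+ suc x ] (suc d) (s≤s le) = Z.-≤- (≤-trans (n≤1+n x) le)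

  rep : ∀ (P i : ℕ) → Σ ℕ λ a → a ≤ P + i × a ⊖ P ≡ + i
  rep P i = P + i , ≤-refl , trans (ZP.⊖-≥ (m≤m+n P i)) (cong +_ (m+n∸m≡n P i))

  repN : ∀ (P i : ℕ) → suc i ≤ P → Σ ℕ λ a → a ≤ P × a ⊖ P ≡ -[1+ i ]
  repN P i le = P ∸ suc i , m∸n≤m P (suc i) ,
    trans (ZP.⊖-< (below P i le)) (cong (λ z → Z.- (+ z)) (m∸[m∸n]≡n le))
    where below : ∀ P i → suc i ≤ P → P ∸ suc i < P
          below (suc q) i _ = s≤s (m∸n≤m q i)

  ∸s : ∀ P a → a < P → P ∸ a ≡ suc (P ∸ suc a)
  ∸s (suc q) a (s≤s le) = +-∸-assoc 1 le

  ε∈L : ∀ (L : Lang) → CondA L → CondB L → L [] ≡ true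
  ε∈L L (w , _ , w∈L) condB = condB [] [] w w∈L

  module Construction (L : Lang) (condA : CondA L) (condB : CondB L)
    (cv : (u w : Word) → L u ≡ true → L w ≡ true → Word)
    (cvOK : ∀ u w pu pw → L (u ++ (cv u w pu pw ++ w)) ≡ true)
    (lw : ℕ → Word) (lwL : ∀ n → L (lw n) ≡ true)
    (lwInf : ∀ w → L w ≡ true → ∀ t → Σ ℕ λ n → t ≤ n × lw n ≡ w) where

    w0 : Word
    w0 = proj₁ condA

    w0L : L w0 ≡ true
    w0L = proj₂ (proj₂ condA)

    w0ne : 1 ≤ length w0
    w0ne with w0 | proj₁ (proj₂ condA)
    ... | [] | w0≢[] = ⊥-elim (w0≢[] refl)
    ... | _ ∷ _ | _ = s≤s z≤n

    -- One step W ↦ W' = A v1 A v2 A with A = W v l v' W, and the three ways of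
    -- cutting W' needed later: around its middle copy of W, and around the
    -- occurrences of l in the first and in the last A.
    module Step (W : Word) (pW : L W ≡ true) (l : Word) (pl : L l ≡ true) where
      v = cv W l pW pl
      x1 = W ++ (v ++ l)
      px1 : L x1 ≡ true
      px1 = cvOK W l pW pl
      v' = cv x1 W px1 pW
      A = x1 ++ (v' ++ W)
      pA : L A ≡ true
      pA = cvOK x1 W px1 pW
      v1 = cv A A pA pA
      B = A ++ (v1 ++ A)
      pB : L B ≡ true
      pB = cvOK A A pA pA
      v2 = cv B A pB pA
      W' = B ++ (v2 ++ A)
      pW' : L W' ≡ true
      pW' = cvOK B A pB pA

      decA : A ≡ (W ++ v) ++ (l ++ (v' ++ W))
      decA = solve 4 (λ W v l v' → ((W ⊕ (v ⊕ l)) ⊕ (v' ⊕ W)) ⊜ ((W ⊕ v) ⊕ (l ⊕ (v' ⊕ W)))) refl W v l v'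

      decMid : W' ≡ (A ++ v1) ++ (W ++ ((v ++ (l ++ (v' ++ W))) ++ (v2 ++ A)))
      decMid = solve 6 (λ W v l v' v1 v2 →
         let A = (W ⊕ (v ⊕ l)) ⊕ (v' ⊕ W) in
         ((A ⊕ (v1 ⊕ A)) ⊕ (v2 ⊕ A)) ⊜ ((A ⊕ v1) ⊕ (W ⊕ ((v ⊕ (l ⊕ (v' ⊕ W))) ⊕ (v2 ⊕ A))))) refl W v l v' v1 v2

      decL : W' ≡ (W ++ v) ++ (l ++ ((v' ++ W) ++ (v1 ++ (A ++ (v2 ++ A)))))
      decL = solve 6 (λ W v l v' v1 v2 →
         let A = (W ⊕ (v ⊕ l)) ⊕ (v' ⊕ W) in
         ((A ⊕ (v1 ⊕ A)) ⊕ (v2 ⊕ A)) ⊜ ((W ⊕ v) ⊕ (l ⊕ ((v' ⊕ W) ⊕ (v1 ⊕ (A ⊕ (v2 ⊕ A))))))) refl W v l v' v1 v2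

      decR : W' ≡ ((A ++ v1) ++ (A ++ (v2 ++ (W ++ v)))) ++ (l ++ (v' ++ W))
      decR = solve 6 (λ W v l v' v1 v2 →
         let A = (W ⊕ (v ⊕ l)) ⊕ (v' ⊕ W) in
         ((A ⊕ (v1 ⊕ A)) ⊕ (v2 ⊕ A)) ⊜ (((A ⊕ v1) ⊕ (A ⊕ (v2 ⊕ (W ⊕ v)))) ⊕ (l ⊕ (v' ⊕ W)))) refl W v l v' v1 v2

      lenWA : length W ≤ length A
      lenWA = ≤-trans (length-++-≤ˡ W {v}) (subst (λ z → length (W ++ v) ≤ length z) (sym decA) (length-++-≤ˡ (W ++ v)))

      lenL : length (W ++ v) + length l ≤ length (A ++ v1)
      lenL = begin
        length (W ++ v) + length l                 ≤⟨ +-monoʳ-≤ (length (W ++ v)) (length-++-≤ˡ l) ⟩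
        length (W ++ v) + length (l ++ (v' ++ W))  ≡⟨ sym (length-++ (W ++ v)) ⟩
        length ((W ++ v) ++ (l ++ (v' ++ W)))      ≡⟨ cong length (sym decA) ⟩
        length A                                   ≤⟨ length-++-≤ˡ A ⟩
        length (A ++ v1)                           ∎
        where open ≤-Reasoning

    -- The sequence W_n ∈ L and the origins p_n (W_n sits in W_{n+1} at |A v1|).
    stage : ℕ → Σ Word (λ w → L w ≡ true)
    stage zero = w0 , w0L
    stage (suc n) = Step.W' (proj₁ (stage n)) (proj₂ (stage n)) (lw n) (lwL n) , Step.pW' (proj₁ (stage n)) (proj₂ (stage n)) (lw n) (lwL n)

    Wn : ℕ → Word
    Wn n = proj₁ (stage n)

    module S (n : ℕ) = Step (Wn n) (proj₂ (stage n)) (lw n) (lwL n)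

    p : ℕ → ℕ
    p zero = 0
    p (suc n) = length (S.A n ++ S.v1 n) + p n

    margins : ∀ n → n ≤ p n × p n + suc n ≤ length (Wn n)
    margins zero = z≤n , w0ne
    margins (suc n) with margins n
    ... | m1 , m2 = ≤-trans (s≤s m1) (+-monoˡ-≤ (p n) α1) , m2'
      where
        α = length (S.A n ++ S.v1 n)
        R = (S.v n ++ (lw n ++ (S.v' n ++ Wn n))) ++ (S.v2 n ++ S.A n)
        W1 : 1 ≤ length (Wn n)
        W1 = ≤-trans (≤-trans (s≤s z≤n) (≤-reflexive (sym (+-suc (p n) n)))) m2
        α1 : 1 ≤ α
        α1 = ≤-trans W1 (≤-trans (S.lenWA n) (length-++-≤ˡ (S.A n) {S.v1 n}))
        R1 : 1 ≤ length R
        R1 = ≤-trans W1 (≤-trans (S.lenWA n) (≤-trans (length-++-≤ʳ (S.A n) {S.v2 n}) (length-++-≤ʳ (S.v2 n ++ S.A n) {S.v n ++ (lw n ++ (S.v' n ++ Wn n))})))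
        m2' : p (suc n) + suc (suc n) ≤ length (Wn (suc n))
        m2' rewrite S.decMid n | length-++ (S.A n ++ S.v1 n) {Wn n ++ R} | length-++ (Wn n) {R}
               | +-assoc α (p n) (suc (suc n)) | +-suc (p n) (suc n) =
          +-monoʳ-≤ α (≤-trans (≤-reflexive (+-comm 1 (p n + suc n))) (+-mono-≤ m2 R1))

    embeds : ∀ n d → Σ Word λ U → Σ Word λ V → Wn (d + n) ≡ U ++ (Wn n ++ V) × length U + p n ≡ p (d + n)
    embeds n zero = [] , [] , sym (++-identityʳ _) , refl
    embeds n (suc d) with embeds n d
    ... | U , V , e , le = X ++ U , V ++ R , eq , len
      where
        m = d + n
        X = S.A m ++ S.v1 m
        R = (S.v m ++ (lw m ++ (S.v' m ++ Wn m))) ++ (S.v2 m ++ S.A m)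
        eq : Wn (suc m) ≡ (X ++ U) ++ (Wn n ++ (V ++ R))
        eq = trans (S.decMid m) (trans (cong (λ z → X ++ (z ++ R)) e)
               (solve 5 (λ X U W V R → (X ⊕ ((U ⊕ (W ⊕ V)) ⊕ R)) ⊜ ((X ⊕ U) ⊕ (W ⊕ (V ⊕ R)))) refl X U (Wn n) V R))
        len : length (X ++ U) + p n ≡ p (suc m)
        len rewrite length-++ X {U} | +-assoc (length X) (length U) (p n) | le = refl

    rearr : ∀ x y z w → (x + y) + (z + w) ≡ (x + z) + (y + w)
    rearr = solve-∀

    windows-agree : ∀ n s a b → a < length (Wn n) → b < length (Wn s) → a + p s ≡ b + p n → nth (Wn n) a ≡ nth (Wn s) b
    windows-agree n s a b la lb eab with embeds n s | embeds s n
    ... | U , V , e , le | U' , V' , e' , le' = trans (sym c1) (trans (cong (nth (Wn m)) idx) c2)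
      where
        m = s + n
        e'' : Wn m ≡ U' ++ (Wn s ++ V')
        e'' = subst (λ z → Wn z ≡ U' ++ (Wn s ++ V')) (+-comm n s) e'
        le'' : length U' + p s ≡ p m
        le'' = trans le' (cong p (+-comm n s))
        c1 : nth (Wn m) (length U + a) ≡ nth (Wn n) a
        c1 = trans (cong (λ w → nth w (length U + a)) e) (trans (nth-app-r U _ a) (nth-app-l (Wn n) V a la))
        c2 : nth (Wn m) (length U' + b) ≡ nth (Wn s) b
        c2 = trans (cong (λ w → nth w (length U' + b)) e'') (trans (nth-app-r U' _ b) (nth-app-l (Wn s) V' b lb))
        idx : length U + a ≡ length U' + b
        idx = +-cancelʳ-≡ (p n + p s) _ _ (begin
            (length U + a) + (p n + p s) ≡⟨ rearr (length U) a (p n) (p s) ⟩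
            (length U + p n) + (a + p s) ≡⟨ cong₂ _+_ le eab ⟩
            p m + (b + p n) ≡⟨ cong (_+ (b + p n)) (sym le'') ⟩
            (length U' + p s) + (b + p n) ≡⟨ rearr (length U') (p s) b (p n) ⟩
            (length U' + b) + (p s + p n) ≡⟨ cong (λ z → (length U' + b) + z) (+-comm (p s) (p n)) ⟩
            (length U' + b) + (p n + p s) ∎)
          where open ≡-Reasoning

    -- ξ(i) is read in a window whose margin on the relevant side exceeds |i|.
    sP : ℕ → ℕ
    sP j = suc (j + j)
    sN : ℕ → ℕ
    sN j = suc (suc (suc (suc (j + j))))

    ξ : BiWord
    ξ (+ j) = nth (Wn (sP j)) (p (sP j) + j)
    ξ -[1+ j ] = nth (Wn (sN j)) (p (sN j) ∸ suc j)

    ξ-window-right : ∀ n a → a < length (Wn n) → (le : p n ≤ a) → ξ (+ (a ∸ p n)) ≡ nth (Wn n) a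
    ξ-window-right n a la le = sym (windows-agree n s a (p s + j) la bnd eqn)
      where
        j = a ∸ p n
        s = sP j
        bnd : p s + j < length (Wn s)
        bnd = ≤-trans (≤-reflexive (sym (+-suc (p s) j)))
                      (≤-trans (+-monoʳ-≤ (p s) (s≤s (≤-trans (m≤m+n j j) (n≤1+n _)))) (proj₂ (margins s)))
        eqn : a + p s ≡ (p s + j) + p n
        eqn = trans (cong (_+ p s) (sym (m∸n+n≡m le))) (lem j (p n) (p s))
          where lem : ∀ x y z → (x + y) + z ≡ (z + x) + y
                lem = solve-∀

    ξ-window-left : ∀ n a → a < length (Wn n) → (lt : a < p n) → ξ -[1+ p n ∸ suc a ] ≡ nth (Wn n) a
    ξ-window-left n a la lt = sym (windows-agree n s a b la bnd eqn)
      where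
        j = p n ∸ suc a
        s = sN j
        b = p s ∸ suc j
        js : suc j ≤ p s
        js = ≤-trans (s≤s (≤-trans (m≤m+n j j) (≤-trans (n≤1+n _) (≤-trans (n≤1+n _) (n≤1+n _))))) (proj₁ (margins s))
        bnd : b < length (Wn s)
        bnd = ≤-trans (s≤s (m∸n≤m (p s) (suc j)))
                      (≤-trans (s≤s (m≤m+n (p s) s)) (≤-trans (≤-reflexive (sym (+-suc (p s) s))) (proj₂ (margins s))))
        pn : p n ≡ suc j + a
        pn = trans (sym (m∸n+n≡m (<⇒≤ lt))) (cong (_+ a) (∸s (p n) a lt))
        eqn : a + p s ≡ b + p n
        eqn = trans (cong (λ z → a + z) (sym (m∸n+n≡m js))) (trans (lem a b (suc j)) (cong (λ z → b + z) (sym pn)))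
          where lem : ∀ x y z → x + (y + z) ≡ y + (z + x)
                lem = solve-∀

    ξ-window : ∀ n a → a < length (Wn n) → ξ (a ⊖ p n) ≡ nth (Wn n) a
    ξ-window n a la with p n ≤? a
    ... | yes le rewrite ZP.⊖-≥ le = ξ-window-right n a la le
    ... | no nle rewrite ZP.⊖-< (≰⇒> nle) | ∸s (p n) a (≰⇒> nle) = ξ-window-left n a la (≰⇒> nle)

    seg-window : ∀ n k a → a + k ≤ length (Wn n) → seg ξ (a ⊖ p n) k ≡ take k (drop a (Wn n))
    seg-window n zero a le = refl
    seg-window n (suc k) a le =
      trans (cong₂ _∷_ (ξ-window n a la) (trans (cong (λ i → seg ξ i k) (⊖+1 a (p n))) (seg-window n k (suc a) le')))
            (cong (take (suc k)) (sym (drop-nth (Wn n) a la)))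
      where
        le' : suc a + k ≤ length (Wn n)
        le' = ≤-trans (≤-reflexive (sym (+-suc a k))) le
        la : a < length (Wn n)
        la = ≤-trans (s≤s (m≤m+n a k)) le'

    occurrence : ∀ m (P x Q : Word) → Wn m ≡ P ++ (x ++ Q) → x ≡ seg ξ (length P ⊖ p m) (length x)
    occurrence m P x Q e = sym (trans (seg-window m (length x) (length P) bnd) (trans (cong (λ w → take (length x) (drop (length P) w)) e) (take-occurrence P x Q)))
      where
        bnd : length P + length x ≤ length (Wn m)
        bnd rewrite e | len3 P x Q = +-monoʳ-≤ (length P) (m≤m+n (length x) (length Q))
    seg∈L : ∀ n a k → a + k ≤ length (Wn n) → L (seg ξ (a ⊖ p n) k) ≡ true
    seg∈L n a k le rewrite seg-window n k a le =
      condB (take a W) (take k (drop a W)) (drop k (drop a W)) (subst (λ w → L w ≡ true) (factor-split W a k) (proj₂ (stage n)))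
      where W = Wn n

    -- F(ξ) ⊆ L: any segment of ξ lies inside a window W_n ∈ L, and L is factorial.
    InF→L : ∀ w → InF ξ w → L w ≡ true
    InF→L w (i , k , e) = subst (λ z → L z ≡ true) (sym e) (go i)
      where
        go : ∀ i → L (seg ξ i k) ≡ true
        go (+ x) with rep (p n) x
          where n = x + k
        ... | a , le , ea = subst (λ i → L (seg ξ i k) ≡ true) ea (seg∈L n a k bnd)
          where
            n = x + k
            bnd : a + k ≤ length (Wn n)
            bnd = ≤-trans (+-monoˡ-≤ k le) (≤-trans (≤-reflexive (+-assoc (p n) x k)) (≤-trans (+-monoʳ-≤ (p n) (n≤1+n n)) (proj₂ (margins n))))
        go -[1+ x ] with repN (p (suc x + k)) x (≤-trans (s≤s (m≤m+n x k)) (proj₁ (margins (suc x + k))))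
        ... | a , le , ea = subst (λ i → L (seg ξ i k) ≡ true) ea (seg∈L n a k bnd)
          where
            n = suc x + k
            bnd : a + k ≤ length (Wn n)
            bnd = ≤-trans (+-mono-≤ le (≤-trans (m≤n+m k x) (n≤1+n _))) (≤-trans (+-monoʳ-≤ (p n) (n≤1+n n)) (proj₂ (margins n)))

    -- L ⊆ F(ξ): each w ∈ L is some ℓ_n, which occurs in W_{n+1}.
    L→InF : ∀ w → L w ≡ true → InF ξ w
    L→InF w pw with lwInf w pw 0
    ... | n , _ , e = _ , _ , trans (sym e) (occurrence (suc n) (Wn n ++ S.v n) (lw n) _ (S.decL n))

    -- Recurrence: w ∈ F(ξ) is ℓ_n for some n > |i|; its occurrence in the first A of
    -- W_{n+1} ends left of i, the one in the last A starts right of i.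
    recurrent-left : ∀ i w → InF ξ w → InFLeft ξ i w
    recurrent-left i w h with lwInf w (InF→L w h) (suc ∣ i ∣)
    ... | n , le , e = j , length w , ineq , eqw
      where
        P = Wn n ++ S.v n
        α = length (S.A n ++ S.v1 n)
        j = length P ⊖ p (suc n)
        eqw : w ≡ seg ξ j (length w)
        eqw = subst (λ z → z ≡ seg ξ j (length z)) e (occurrence (suc n) P (lw n) _ (S.decL n))
        k = length w
        c = length P + k
        cα : c ≤ α
        cα = subst (λ z → length P + length z ≤ α) e (S.lenL n)
        d = (α + p n) ∸ c
        dn : ∣ i ∣ ≤ d
        dn = ≤-trans (≤-trans (n≤1+n _) le) (≤-trans (proj₁ (margins n))
               (≤-trans (≤-reflexive (sym (m+n∸m≡n c (p n)))) (∸-monoˡ-≤ c (+-monoˡ-≤ (p n) cα))))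
        ineq : j Z.+ + length w Z.≤ i Z.+ Z.1ℤ
        ineq rewrite ⊖+ (length P) (p (suc n)) k | ZP.⊖-≤ (≤-trans cα (m≤m+n α (p n))) = le-neg i d dn

    recurrent-right : ∀ i w → InF ξ w → InFRight ξ i w
    recurrent-right i w h with lwInf w (InF→L w h) (suc ∣ i ∣)
    ... | n , le , e = j , length w , ineq , eqw
      where
        R2 = S.A n ++ (S.v2 n ++ (Wn n ++ S.v n))
        P2 = (S.A n ++ S.v1 n) ++ R2
        α = length (S.A n ++ S.v1 n)
        j = length P2 ⊖ p (suc n)
        eqw : w ≡ seg ξ j (length w)
        eqw = subst (λ z → z ≡ seg ξ j (length z)) e (occurrence (suc n) P2 (lw n) _ (S.decR n))
        big : p n + suc n ≤ length R2
        big = ≤-trans (proj₂ (margins n)) (≤-trans (S.lenWA n) (length-++-≤ˡ (S.A n)))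
        d = length R2 ∸ p n
        dn : ∣ i ∣ ≤ d
        dn = ≤-trans (≤-trans (n≤1+n _) le) (≤-trans (n≤1+n n) (≤-trans (≤-reflexive (sym (m+n∸m≡n (p n) (suc n)))) (∸-monoˡ-≤ (p n) big)))
        ineq : i Z.≤ j
        ineq rewrite length-++ (S.A n ++ S.v1 n) {R2} | ⊖-cancel α (length R2) (p n)
                   | ZP.⊖-≥ (≤-trans (m≤m+n (p n) (suc n)) big) = le-pos i d dn

    recurrent : Recurrent ξ
    recurrent i w = mk⇔ (recurrent-left i w) (λ { (j , k , _ , e) → j , k , e }) , mk⇔ (recurrent-right i w) (λ { (j , k , _ , e) → j , k , e })

    factors : FactorsAre ξ L
    factors w = mk⇔ (InF→L w) (L→InF w)

module Characterisation where
  open import Defs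
  open WordCoding using (decode; dec-enc; sweep; sweep-hits)
  open Windows using (len3; ε∈L; module Construction)
  open import Data.Nat using (ℕ; _+_; _≤_; pred)
  open import Data.Integer as Z using (+_; ∣_∣)
  import Data.Integer.Properties as ZP
  import Data.Integer.Tactic.RingSolver as ZR
  open import Data.Bool using (true; false; if_then_else_)
  open import Data.List using ([]; _∷_; _++_; length; drop)
  open import Data.Product using (Σ; _,_; proj₁; proj₂; _×_)
  open import Relation.Binary.PropositionalEquality
  open import Function.Bundles using (Equivalence)

  seg-split : ∀ (ξ : BiWord) i a b → seg ξ i (a + b) ≡ seg ξ i a ++ seg ξ (i Z.+ + a) b
  seg-split ξ i 0 b = cong (λ z → seg ξ z b) (sym (ZP.+-identityʳ i))
  seg-split ξ i (ℕ.suc a) b = cong (ξ i ∷_) (trans (seg-split ξ (i Z.+ Z.1ℤ) a b)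
                               (cong (λ z → seg ξ (i Z.+ Z.1ℤ) a ++ seg ξ z b) (ZP.+-assoc i (+ 1) (+ a))))

  len-seg : ∀ (ξ : BiWord) i k → length (seg ξ i k) ≡ k
  len-seg ξ i 0 = refl
  len-seg ξ i (ℕ.suc k) = cong ℕ.suc (len-seg ξ _ k)

  app-inj : ∀ (a b c d : Word) → length a ≡ length c → a ++ b ≡ c ++ d → a ≡ c × b ≡ d
  app-inj [] b [] d _ e = refl , e
  app-inj (x ∷ a) b (y ∷ c) d l e with app-inj a b c d (cong pred l) (cong (drop 1) e)
  ... | e1 , e2 = cong₂ _∷_ (cong (λ { [] → x ; (z ∷ _) → z }) e) e1 , e2

  -- (i) ⇒ (ii).  (a): a one-letter segment.  (b): a factor of a segment is a
  -- segment.  (c): by recurrence, an occurrence of w starts right of the end of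
  -- an occurrence of u, and the segment spanning both is in F(ξ) = L.
  module NecessaryConditions (L : Lang) (ξ : BiWord) (rec : Recurrent ξ) (fac : FactorsAre ξ L) where
    toL : ∀ {w} → InF ξ w → L w ≡ true
    toL = Equivalence.to (fac _)

    fromL : ∀ {w} → L w ≡ true → InF ξ w
    fromL = Equivalence.from (fac _)

    condA : CondA L
    condA = (ξ (+ 0) ∷ []) , (λ ()) , toL (+ 0 , 1 , refl)

    condB : CondB L
    condB u v w uvw∈L with fromL uvw∈L
    ... | i , k , e = toL (i Z.+ + length u , length v , proj₁ v-seg)
      where
        k≡ : k ≡ length u + (length v + length w)
        k≡ = trans (sym (len-seg ξ i k)) (trans (cong length (sym e)) (len3 u v w))
        split3 : u ++ (v ++ w) ≡ seg ξ i (length u) ++ (seg ξ (i Z.+ + length u) (length v) ++ seg ξ _ (length w))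
        split3 = trans e (trans (cong (seg ξ i) k≡) (trans (seg-split ξ i (length u) _)
                   (cong (seg ξ i (length u) ++_) (seg-split ξ _ (length v) (length w)))))
        vw-seg = proj₂ (app-inj u (v ++ w) (seg ξ i (length u)) _ (sym (len-seg ξ i _)) split3)
        v-seg = app-inj v w (seg ξ _ (length v)) _ (sym (len-seg ξ _ _)) vw-seg

    condC : CondC L
    condC u w u∈L w∈L with fromL u∈L
    ... | i , k1 , eu with Equivalence.to (proj₂ (rec (i Z.+ + k1) w)) (fromL w∈L)
    ...   | j , k2 , le , ew = v , toL (i , k1 + (d + k2) , eq)
      where
        i' = i Z.+ + k1
        d = ∣ j Z.- i' ∣
        dj : i' Z.+ + d ≡ j
        dj = trans (cong (λ z → i' Z.+ z) (ZP.0≤i⇒+∣i∣≡i (ZP.i≤j⇒0≤j-i le))) (lem i' j)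
          where lem : ∀ a b → a Z.+ (b Z.- a) ≡ b
                lem = ZR.solve-∀
        v = seg ξ i' d
        eq : u ++ (v ++ w) ≡ seg ξ i (k1 + (d + k2))
        eq = sym (trans (seg-split ξ i k1 (d + k2)) (cong₂ _++_ (sym eu)
               (trans (seg-split ξ i' d k2) (cong (v ++_) (trans (cong (λ z → seg ξ z k2) dj) (sym ew))))))

    condII : CondII L
    condII = condA , condB , condC

  -- (ii) ⇒ (i): run the construction with the connectors given by (c) and the
  -- enumeration n ↦ decode (sweep n) of all words, with non-members replaced by ε.
  module Sufficiency (L : Lang) (c2 : CondII L) where
    condA : CondA L
    condA = proj₁ c2

    condB : CondB L
    condB = proj₁ (proj₂ c2)

    condC : CondC L
    condC = proj₂ (proj₂ c2)

    lw : ℕ → Word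
    lw n = if L (decode (sweep n)) then decode (sweep n) else []

    lwL : ∀ n → L (lw n) ≡ true
    lwL n with L (decode (sweep n)) in eq
    ... | true = eq
    ... | false = ε∈L L condA condB

    lwInf : ∀ w → L w ≡ true → ∀ t → Σ ℕ λ n → t ≤ n × lw n ≡ w
    lwInf w w∈L t with sweep-hits (encode w) t
    ... | m , le , e = m , le , goal
      where goal : lw m ≡ w
            goal rewrite e | dec-enc w | w∈L = refl

    open Construction L condA condB (λ u w pu pw → proj₁ (condC u w pu pw))
                      (λ u w pu pw → proj₂ (condC u w pu pw)) lw lwL lwInf public

module RecursiveWordToRE where
  open import Defs
  open Computability
  open EvaluatorCorrectness using (mu-root)
  open WordCoding
  open Characterisation using (seg-split; len-seg)
  open import Data.Nat using (ℕ; zero; suc; _+_; _*_; _∸_; _≤_; z≤n)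
  open import Data.Nat.Properties
  open import Data.Integer using (+_)
  open import Data.Bool using (true; false)
  open import Data.Fin using (zero; suc)
  open import Data.Vec using ([]; _∷_)
  open import Data.List using ([]; _∷_; _++_; length)
  open import Data.Product using (Σ; _,_; proj₁; proj₂; _×_)
  open import Data.Sum using (inj₁; inj₂)
  open import Relation.Binary.PropositionalEquality
  open import Function.Bundles using (mk⇔; Equivalence)

  -- By recurrence every
  -- factor occurs at a position j ≥ 0, as a prefix of ξ[j,∞) of length at most
  -- its code n; so L is the domain of the search  μ j. ∃ k ≤ n. code (ξ[j, j+k)) = n,
  -- where the bounded ∃ is the product of the distances |code - n| over k ≤ n.

  dist : ℕ → ℕ → ℕ
  dist a b = (a ∸ b) + (b ∸ a)

  dist0 : ∀ a b → dist a b ≡ 0 → a ≡ b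
  dist0 a b e = ≤-antisym (m∸n≡0⇒m≤n (m+n≡0⇒m≡0 (a ∸ b) e)) (m∸n≡0⇒m≤n (m+n≡0⇒n≡0 (a ∸ b) e))

  distR : ∀ a → dist a a ≡ 0
  distR a rewrite n∸n≡0 a = refl

  cDist : Computable₂ dist
  cDist = cExt (ap2 cAdd (ap2 cMonus (cP zero) (cP (suc zero))) (ap2 cMonus (cP (suc zero)) (cP zero))) λ { (a ∷ b ∷ []) → refl }

  module RecursiveToRE (L : Lang) (ξ : BiWord) (rec : Recurrent ξ) (fac : FactorsAre ξ L) (rb : RecursiveBiWord ξ) where
    χ : ℕ → ℕ
    χ n = b2n (wordBit ξ n)

    cχ : Computable₁ χ
    cχ = recursive→indicator (wordBit ξ) rb

    χeven : ∀ j → χ (j + j) ≡ b2n (ξ (+ j))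
    χeven j rewrite wordBit-eq ξ (j + j) | proj₁ (pe j) | proj₂ (pe j) = refl

    Ef : ℕ → ℕ → ℕ
    Ef k j = encode (seg ξ (+ j) k)

    Estep : ∀ k j → Ef (suc k) j ≡ Ef k j + pw k * suc (χ ((j + k) + (j + k)))
    Estep k j rewrite χeven (j + k) = begin
        encode (seg ξ (+ j) (suc k)) ≡⟨ cong (λ z → encode (seg ξ (+ j) z)) (+-comm 1 k) ⟩
        encode (seg ξ (+ j) (k + 1)) ≡⟨ cong encode (seg-split ξ (+ j) k 1) ⟩
        encode (seg ξ (+ j) k ++ (ξ (+ (j + k)) ∷ [])) ≡⟨ enc++' (seg ξ (+ j) k) _ ⟩
        Ef k j + pw (length (seg ξ (+ j) k)) * encode (ξ (+ (j + k)) ∷ []) ≡⟨ cong₂ (λ a b → Ef k j + pw a * b) (len-seg ξ (+ j) k) (e1 (ξ (+ (j + k)))) ⟩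
        Ef k j + pw k * suc (b2n (ξ (+ (j + k)))) ∎
      where open ≡-Reasoning
            e1 : ∀ b → encode (b ∷ []) ≡ suc (b2n b)
            e1 false = refl
            e1 true = refl

    cE : Computable₂ Ef
    cE = cExt (cR cZ st) λ { (k ∷ j ∷ []) → go k j }
      where
        stf : Fn 3
        stf (k ∷ r ∷ j ∷ []) = r + pw k * suc (χ ((j + k) + (j + k)))
        st : Computable stf
        st = cExt (ap2 cAdd (cP (suc zero)) (ap2 cMul (cPw $1 cP zero) (cS $1 cχ $1 ap2 cAdd jk jk)))
                  λ { (k ∷ r ∷ j ∷ []) → refl }
          where jk = ap2 cAdd (cP (suc (suc zero))) (cP zero)
        go : ∀ k j → recN (λ _ → 0) stf k (j ∷ []) ≡ Ef k j
        go zero j = refl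
        go (suc k) j rewrite go k j = sym (Estep k j)

    Df : ℕ → ℕ → ℕ → ℕ
    Df k j n = dist (Ef k j) n

    Pf : ℕ → ℕ → ℕ → ℕ
    Pf zero j n = Df 0 j n
    Pf (suc K) j n = Pf K j n * Df (suc K) j n

    cD : Computable₃ Df
    cD = cExt (ap2 cDist (ap2 cE (cP zero) (cP (suc zero))) (cP (suc (suc zero)))) λ { (k ∷ j ∷ n ∷ []) → refl }

    cPf : Computable₃ Pf
    cPf = cExt (cR base st) λ { (K ∷ j ∷ n ∷ []) → go K j n }
      where
        base : Computable (binary (Df 0))
        base = cExt (cC cD (cZ ∷c cP zero ∷c cP (suc zero) ∷c []c)) λ { (j ∷ n ∷ []) → refl }
        stf : Fn 4
        stf (K ∷ r ∷ j ∷ n ∷ []) = r * Df (suc K) j n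
        st : Computable stf
        st = cExt (ap2 cMul (cP (suc zero)) (cC cD ((cS $1 cP zero) ∷c cP (suc (suc zero)) ∷c cP (suc (suc (suc zero))) ∷c []c)))
                  λ { (K ∷ r ∷ j ∷ n ∷ []) → refl }
        go : ∀ K j n → recN (binary (Df 0)) stf K (j ∷ n ∷ []) ≡ Pf K j n
        go zero j n = refl
        go (suc K) j n rewrite go K j n = refl

    Tf : ℕ → ℕ → ℕ
    Tf j n = Pf n j n

    cT : Computable₂ Tf
    cT = cExt (cC cPf (cP (suc zero) ∷c cP zero ∷c cP (suc zero) ∷c []c)) λ { (j ∷ n ∷ []) → refl }

    Pf-zero : ∀ K j n k → k ≤ K → Df k j n ≡ 0 → Pf K j n ≡ 0
    Pf-zero zero j n .zero z≤n e = e
    Pf-zero (suc K) j n k le e with m≤n⇒m<n∨m≡n le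
    ... | inj₁ lt rewrite Pf-zero K j n k (≤-pred lt) e = refl
    ... | inj₂ refl rewrite e = *-zeroʳ (Pf K j n)

    Pf-zero-witness : ∀ K j n → Pf K j n ≡ 0 → Σ ℕ λ k → k ≤ K × Df k j n ≡ 0
    Pf-zero-witness zero j n e = 0 , z≤n , e
    Pf-zero-witness (suc K) j n e with m*n≡0⇒m≡0∨n≡0 (Pf K j n) e
    ... | inj₁ e' with Pf-zero-witness K j n e'
    ...   | k , le , d = k , ≤-trans le (n≤1+n K) , d
    Pf-zero-witness (suc K) j n e | inj₂ e' = suc K , ≤-refl , e'

    code : Code 1
    code = mu (proj₁ cT)

    halts→ : ∀ n y → code ⟦ n ∷ [] ⟧⇓ y → LangAsSet L n
    halts→ n y d with Pf-zero-witness n y n (mu-root cT d)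
    ... | k , _ , dz = seg ξ (+ y) k , dist0 _ _ dz , Equivalence.to (fac _) (+ y , k , refl)

    →halts : ∀ n → LangAsSet L n → Σ ℕ λ y → code ⟦ n ∷ [] ⟧⇓ y
    →halts n (w , ew , w∈L) with Equivalence.to (proj₂ (rec (+ 0) w)) (Equivalence.from (fac w) w∈L)
    ... | + j , k , _ , e with leastRoot (λ m → Tf m n) j root
      where
        k≤n : k ≤ n
        k≤n = subst₂ _≤_ (trans (cong length e) (len-seg ξ (+ j) k)) ew (len≤enc w)
        hit : Df k j n ≡ 0
        hit = subst (λ z → dist z n ≡ 0) (cong encode e) (subst (λ z → dist (encode w) z ≡ 0) ew (distR (encode w)))
        root : Tf j n ≡ 0
        root = Pf-zero n j n k k≤n hit
    ... | m , least = m , muOK cT (n ∷ []) m least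

    re : RELang L
    re = code , λ n → mk⇔ (→halts n) (λ { (y , d) → halts→ n y d })

module REToRecursiveWord where
  open import Defs
  open Computability
  open ClockedEvaluator using (evalC; cEval; tabC)
  open EvaluatorCorrectness using (sound; complete; mono)
  open WordCoding
  open Windows using (ε∈L; module Construction)
  open import Data.Nat using (ℕ; zero; suc; _+_; _*_; _∸_; _≤_; _⊔_)
  open import Data.Nat.Properties
  open import Data.Bool using (true)
  open import Data.Fin using (zero; suc)
  open import Data.Vec using ([]; _∷_; lookup)
  open import Data.Vec.Properties using (tabulate∘lookup)
  open import Data.List using ([]; _++_; length)
  open import Data.Product using (Σ; _,_; proj₁; proj₂; _×_)
  import Data.Sum
  open import Relation.Binary.PropositionalEquality
  open import Function.Bundles using (Equivalence)

  -- Fix a code e0 whose domain is L.  Both parameters of the construction are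
  -- made effective by dovetailing along the sweep:
  --  * connectors: cv u w = decode (sweep m) for the least m such that e0 halts
  --    within m steps on the code of u (decode (sweep m)) w;
  --  * enumeration: ℓ_m = decode (sweep m) if e0 halts on it within m steps, else ε.
  -- Then the codes of W_n and the origins p_n are primitive-recursive in the
  -- outputs of these searches, so every letter ξ(i) = W_n(p_n + i) is computable.

  cConst : ∀ {n} c → Computable {n} (λ _ → c)
  cConst zero = cZ
  cConst (suc c) = cS $1 cConst c

  letC : ∀ {n} → Code n → Code (suc n) → Code n
  letC s b = comp b (s ∷ codes (tabC (λ i → i)))

  letOK : ∀ {n} {s : Code n} {b xs a y} → s ⟦ xs ⟧⇓ a → b ⟦ a ∷ xs ⟧⇓ y → letC s b ⟦ xs ⟧⇓ y
  letOK {xs = xs} ds db = ev-comp (ev-∷ ds identity) db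
    where identity : codes (tabC (λ i → i)) ⟦ xs ⟧⇓* xs
          identity = subst (codes (tabC (λ i → i)) ⟦ xs ⟧⇓*_) (tabulate∘lookup xs) (codes-ok (tabC (λ i → i)) xs)

  app2C : ∀ {n} → Code 2 → {f g : Fn n} → Computable f → Computable g → Code n
  app2C s cf cg = comp s (proj₁ cf ∷ proj₁ cg ∷ [])

  app2OK : ∀ {n} {s : Code 2} {f g : Fn n} (cf : Computable f) (cg : Computable g) {xs y} →
           s ⟦ f xs ∷ g xs ∷ [] ⟧⇓ y → app2C s cf cg ⟦ xs ⟧⇓ y
  app2OK cf cg {xs} d = ev-comp (ev-∷ (proj₂ cf xs) (ev-∷ (proj₂ cg xs) ev-[])) d

  nsg0 : ∀ x → nsg x ≡ 0 → Σ ℕ λ y → x ≡ suc y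
  nsg0 (suc y) _ = y , refl

  module REToRecursive (L : Lang) (c2 : CondII L) (re : RELang L) where
    e0 : Code 1
    e0 = proj₁ re

    condA : CondA L
    condA = proj₁ c2

    condB : CondB L
    condB = proj₁ (proj₂ c2)

    condC : CondC L
    condC = proj₂ (proj₂ c2)

    ev : ℕ → ℕ → ℕ
    ev t n = evalC t e0 (n ∷ [])

    cEv : Computable₂ ev
    cEv = cExt (cEval e0) λ { (t ∷ n ∷ []) → refl }

    inL : ∀ t n y → ev t n ≡ suc y → L (decode n) ≡ true
    inL t n y e with Equivalence.from (proj₂ re n) (y , sound t e0 (n ∷ []) y e)
    ... | w , ew , pw = subst (λ z → L z ≡ true) (trans (sym (dec-enc w)) (cong decode ew)) pw

    confirm : ∀ w → L w ≡ true → Σ ℕ λ t → Σ ℕ λ y → ev t (encode w) ≡ suc y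
    confirm w pw with Equivalence.to (proj₂ re (encode w)) (w , refl , pw)
    ... | y , d with complete d
    ...   | t , e = t , y , e

    test : ℕ → ℕ → ℕ → ℕ
    test m u w = nsg (ev m (catN u (catN (sweep m) w)))

    cTest : Computable₃ test
    cTest = cExt (cNsg $1 ap2 cEv (cP zero) (ap2 cCat (cP (suc zero)) (ap2 cCat (cSweep $1 cP zero) (cP (suc (suc zero))))))
                 λ { (m ∷ u ∷ w ∷ []) → refl }

    hasRoot : ∀ u w → L u ≡ true → L w ≡ true → Σ ℕ λ m → test m (encode u) (encode w) ≡ 0
    hasRoot u w pu pw with condC u w pu pw
    ... | v0 , pv with confirm (u ++ (v0 ++ w)) pv
    ...   | t0 , y , ey with sweep-hits (encode v0) t0
    ...     | m , le , ek = m , goal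
      where
        goal : test m (encode u) (encode w) ≡ 0
        goal rewrite ek | sym (enc++ v0 w) | sym (enc++ u (v0 ++ w)) | mono t0 m e0 _ y le ey = nsg-suc y

    -- The effective connector (kept opaque: only cvOK and SOK are needed about it).
    srch : ∀ u w → L u ≡ true → L w ≡ true → Σ ℕ (LeastRoot (λ m → test m (encode u) (encode w)))
    srch u w pu pw = leastRoot _ (proj₁ (hasRoot u w pu pw)) (proj₂ (hasRoot u w pu pw))

    opaque
      cv : (u w : Word) → L u ≡ true → L w ≡ true → Word
      cv u w pu pw = decode (sweep (proj₁ (srch u w pu pw)))

    opaque
      unfolding cv
      cvOK : ∀ u w pu pw → L (u ++ (cv u w pu pw ++ w)) ≡ true
      cvOK u w pu pw with srch u w pu pw
      ... | m , z , _ with nsg0 _ z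
      ...   | y , e = subst (λ q → L q ≡ true) eqw (inL m _ y e)
        where
          eqw : decode (catN (encode u) (catN (sweep m) (encode w))) ≡ u ++ (decode (sweep m) ++ w)
          eqw = trans (cong (λ z → decode (catN (encode u) (catN z (encode w)))) (sym (enc-dec (sweep m))))
                  (trans (cong decode (trans (cong (catN (encode u)) (sym (enc++ (decode (sweep m)) w))) (sym (enc++ u (decode (sweep m) ++ w))))) (dec-enc _))

    selW : ℕ → Word → Word
    selW zero c = []
    selW (suc _) c = c

    lw : ℕ → Word
    lw n = selW (ev n (sweep n)) (decode (sweep n))

    lwL : ∀ n → L (lw n) ≡ true
    lwL n with ev n (sweep n) in eq
    ... | zero = ε∈L L condA condB
    ... | suc y = inL n (sweep n) y eq

    lwInf : ∀ w → L w ≡ true → ∀ t → Σ ℕ λ n → t ≤ n × lw n ≡ w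
    lwInf w pw t with confirm w pw
    ... | t0 , y , ey with sweep-hits (encode w) (t ⊔ t0)
    ...   | m , le , ek = m , ≤-trans (m≤m⊔n t t0) le , goal
      where
        goal : lw m ≡ w
        goal rewrite ek | mono t0 m e0 (encode w ∷ []) y (≤-trans (m≤n⊔m t t0) le) ey = dec-enc w

    elw : ℕ → ℕ
    elw n = sg (ev n (sweep n)) * sweep n

    elwOK : ∀ n → elw n ≡ encode (lw n)
    elwOK n with ev n (sweep n)
    ... | zero = refl
    ... | suc y rewrite sg-suc y = trans (+-identityʳ (sweep n)) (sym (enc-dec (sweep n)))

    cElw : Computable₁ elw
    cElw = cExt (ap2 cMul (cSg $1 ap2 cEv (cP zero) (cSweep $1 cP zero)) (cSweep $1 cP zero)) λ { (n ∷ []) → refl }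

    open Construction L condA condB cv cvOK lw lwL lwInf public

    Scode : Code 2
    Scode = comp (proj₁ cSweep) (mu (proj₁ cTest) ∷ [])

    opaque
      unfolding cv
      SOK : ∀ a b u w pu pw → a ≡ encode u → b ≡ encode w → Scode ⟦ a ∷ b ∷ [] ⟧⇓ encode (cv u w pu pw)
      SOK a b u w pu pw refl refl with srch u w pu pw
      ... | m , z , nz = subst (Scode ⟦ encode u ∷ encode w ∷ [] ⟧⇓_) (sym (enc-dec (sweep m)))
                           (ev-comp (ev-∷ (muOK cTest (encode u ∷ encode w ∷ []) m (z , nz)) ev-[]) (proj₂ cSweep (m ∷ [])))

    fx1 : ℕ → ℕ → ℕ → ℕ
    fx1 x v l = catN x (catN v l)
    fA : ℕ → ℕ → ℕ → ℕ → ℕ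
    fA x v l v' = catN (fx1 x v l) (catN v' x)
    fB : ℕ → ℕ → ℕ
    fB a v1 = catN a (catN v1 a)

    cFx1 : ∀ {n} {f g h : Fn n} → Computable f → Computable g → Computable h → Computable (λ xs → fx1 (f xs) (g xs) (h xs))
    cFx1 a b c = ap2 cCat a (ap2 cCat b c)
    cFA : ∀ {n} {f g h i : Fn n} → Computable f → Computable g → Computable h → Computable i → Computable (λ xs → fA (f xs) (g xs) (h xs) (i xs))
    cFA a b c d = ap2 cCat (cFx1 a b c) (ap2 cCat d a)
    cFB : ∀ {n} {f g : Fn n} → Computable f → Computable g → Computable (λ xs → fB (f xs) (g xs))
    cFB a b = ap2 cCat a (ap2 cCat b a)

    eW : ℕ → ℕ
    eW k = encode (Wn k)

    -- From (k, code W_k, rest), chain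
    -- pushes l = ℓ_k, v, v', v1, v2 (each connector obtained by Scode from the
    -- codes of the words around it) and runs body on (v2 v1 v' v l k code W_k rest).
    -- A3c, A4c, X1c, B4c rebuild x1, A, B from the stack at the depth where used.
    A3c : ∀ m → Computable {5 + m} λ xs → fA (lookup xs (suc (suc (suc (suc zero))))) (lookup xs (suc zero))
                                             (lookup xs (suc (suc zero))) (lookup xs zero)
    A3c m = cFA {5 + m} (cP (suc (suc (suc (suc zero))))) (cP (suc zero)) (cP (suc (suc zero))) (cP zero)
    A4c : ∀ m → Computable {6 + m} λ xs → fA (lookup xs (suc (suc (suc (suc (suc zero)))))) (lookup xs (suc (suc zero)))
                                             (lookup xs (suc (suc (suc zero)))) (lookup xs (suc zero))
    A4c m = cFA {6 + m} (cP (suc (suc (suc (suc (suc zero)))))) (cP (suc (suc zero))) (cP (suc (suc (suc zero)))) (cP (suc zero))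
    X1c : ∀ m → Computable {4 + m} λ xs → fx1 (lookup xs (suc (suc (suc zero)))) (lookup xs zero) (lookup xs (suc zero))
    X1c m = cFx1 (cP (suc (suc (suc zero)))) (cP zero) (cP (suc zero))
    B4c : ∀ m → Computable {6 + m} λ xs → fB (fA (lookup xs (suc (suc (suc (suc (suc zero)))))) (lookup xs (suc (suc zero)))
                                                 (lookup xs (suc (suc (suc zero)))) (lookup xs (suc zero)))
                                             (lookup xs zero)
    B4c m = cFB (A4c m) (cP zero)
    Lc : ∀ m → Computable {2 + m} λ xs → elw (lookup xs zero)
    Lc m = cElw $1 cP zero

    chain : ∀ {m} → Code (7 + m) → Code (2 + m)
    chain {m} body =
      letC (proj₁ (Lc m))
      (letC (app2C Scode (cP (suc (suc zero))) (cP zero))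
      (letC (app2C Scode (X1c m) (cP (suc (suc (suc zero)))))
      (letC (app2C Scode (A3c m) (A3c m))
      (letC (app2C Scode (B4c m) (A4c m)) body))))

    ex1 : ∀ k → fx1 (eW k) (encode (S.v k)) (elw k) ≡ encode (S.x1 k)
    ex1 k = trans (cong (λ z → catN (eW k) (catN (encode (S.v k)) z)) (elwOK k))
                (trans (cong (catN (eW k)) (sym (enc++ (S.v k) (lw k)))) (sym (enc++ (Wn k) (S.v k ++ lw k))))
    eA : ∀ k → fA (eW k) (encode (S.v k)) (elw k) (encode (S.v' k)) ≡ encode (S.A k)
    eA k = trans (cong (λ z → catN z (catN (encode (S.v' k)) (eW k))) (ex1 k))
               (trans (cong (catN (encode (S.x1 k))) (sym (enc++ (S.v' k) (Wn k)))) (sym (enc++ (S.x1 k) (S.v' k ++ Wn k))))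
    eB : ∀ k → fB (fA (eW k) (encode (S.v k)) (elw k) (encode (S.v' k))) (encode (S.v1 k)) ≡ encode (S.B k)
    eB k = trans (cong (λ z → fB z (encode (S.v1 k))) (eA k))
               (trans (cong (catN (encode (S.A k))) (sym (enc++ (S.v1 k) (S.A k)))) (sym (enc++ (S.A k) (S.v1 k ++ S.A k))))

    chainOK : ∀ {m} {f : Fn (7 + m)} (cb : Computable f) k rest →
      chain (proj₁ cb) ⟦ k ∷ eW k ∷ rest ⟧⇓ f (encode (S.v2 k) ∷ encode (S.v1 k) ∷ encode (S.v' k) ∷ encode (S.v k) ∷ elw k ∷ k ∷ eW k ∷ rest)
    chainOK {m} cb k rest =
      letOK (proj₂ (Lc m) (k ∷ eW k ∷ rest))
      (letOK (app2OK (cP (suc (suc zero))) (cP zero) (SOK _ _ (Wn k) (lw k) (proj₂ (stage k)) (lwL k) refl (elwOK k)))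
      (letOK (app2OK (X1c m) (cP (suc (suc (suc zero))))
                 (SOK _ _ (S.x1 k) (Wn k) (S.px1 k) (proj₂ (stage k)) (ex1 k) refl))
      (letOK (app2OK (A3c m) (A3c m) (SOK _ _ (S.A k) (S.A k) (S.pA k) (S.pA k) (eA k) (eA k)))
      (letOK (app2OK (B4c m) (A4c m) (SOK _ _ (S.B k) (S.A k) (S.pB k) (S.pA k) (eB k) (eA k)))
      (proj₂ cb _)))))

    -- The next window W_{k+1} = B v2 A; positions in the stack: v2 v1 v' v l k (code W_k) rest.
    A7f : ∀ {m} → Fn (7 + m)
    A7f xs = fA (lookup xs (suc (suc (suc (suc (suc (suc zero)))))))
                (lookup xs (suc (suc (suc zero)))) (lookup xs (suc (suc (suc (suc zero)))))
                (lookup xs (suc (suc zero)))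

    A7 : ∀ {m} → Computable {7 + m} A7f
    A7 = cFA (cP (suc (suc (suc (suc (suc (suc zero))))))) (cP (suc (suc (suc zero)))) (cP (suc (suc (suc (suc zero))))) (cP (suc (suc zero)))

    bodyWf : Fn 7
    bodyWf xs = catN (fB (A7f xs) (lookup xs (suc zero))) (catN (lookup xs zero) (A7f xs))

    bodyW : Computable bodyWf
    bodyW = ap2 cCat (cFB A7 (cP (suc zero))) (ap2 cCat (cP zero) A7)

    stepW : Code 2
    stepW = chain (proj₁ bodyW)

    encAB : ∀ (a b : Word) → catN (encode a) (catN (encode b) (encode a)) ≡ encode (a ++ (b ++ a))
    encAB a b = trans (cong (catN (encode a)) (sym (enc++ b a))) (sym (enc++ a (b ++ a)))

    encAB' : ∀ (a b c : Word) → catN (encode a) (catN (encode b) (encode c)) ≡ encode (a ++ (b ++ c))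
    encAB' a b c = trans (cong (catN (encode a)) (sym (enc++ b c))) (sym (enc++ a (b ++ c)))

    stepOK : ∀ k → stepW ⟦ k ∷ eW k ∷ [] ⟧⇓ eW (suc k)
    stepOK k = subst (stepW ⟦ k ∷ eW k ∷ [] ⟧⇓_) eq (chainOK bodyW k [])
      where
        eq : catN (fB (fA (eW k) (encode (S.v k)) (elw k) (encode (S.v' k))) (encode (S.v1 k)))
                  (catN (encode (S.v2 k)) (fA (eW k) (encode (S.v k)) (elw k) (encode (S.v' k)))) ≡ eW (suc k)
        eq = trans (cong (λ z → catN (fB z (encode (S.v1 k))) (catN (encode (S.v2 k)) z)) (eA k))
             (trans (cong (λ z → catN z (catN (encode (S.v2 k)) (encode (S.A k)))) (encAB (S.A k) (S.v1 k)))
                    (encAB' (S.B k) (S.v2 k) (S.A k)))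

    cNW : Computable₁ eW
    cNW = prec (proj₁ (cConst {0} (encode w0))) stepW , λ { (k ∷ []) → go k }
      where go : ∀ k → prec (proj₁ (cConst {0} (encode w0))) stepW ⟦ k ∷ [] ⟧⇓ eW k
            go zero = ev-prec0 (proj₂ (cConst {0} (encode w0)) [])
            go (suc k) = ev-precS (go k) (stepOK k)

    bodyPf : Fn 8
    bodyPf xs = lenN (catN (A7f xs) (lookup xs (suc zero))) + lookup xs (suc (suc (suc (suc (suc (suc (suc zero)))))))

    bodyP : Computable bodyPf
    bodyP = ap2 cAdd (cLen $1 ap2 cCat A7 (cP (suc zero))) (cP (suc (suc (suc (suc (suc (suc (suc zero))))))))

    pre : Computables {2} (λ xs → lookup xs zero ∷ eW (lookup xs zero) ∷ lookup xs (suc zero) ∷ [])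
    pre = cP zero ∷c (cNW $1 cP zero) ∷c cP (suc zero) ∷c []c

    pstep : Code 2
    pstep = comp (chain (proj₁ bodyP)) (codes pre)

    pstepOK : ∀ k r → pstep ⟦ k ∷ r ∷ [] ⟧⇓ (length (S.A k ++ S.v1 k) + r)
    pstepOK k r = ev-comp (codes-ok pre (k ∷ r ∷ []))
                    (subst (chain (proj₁ bodyP) ⟦ k ∷ eW k ∷ r ∷ [] ⟧⇓_) eq (chainOK bodyP k (r ∷ [])))
      where
        eq : lenN (catN (fA (eW k) (encode (S.v k)) (elw k) (encode (S.v' k))) (encode (S.v1 k))) + r ≡ length (S.A k ++ S.v1 k) + r
        eq = trans (cong (λ z → lenN (catN z (encode (S.v1 k))) + r) (eA k))
             (trans (cong (λ z → lenN z + r) (sym (enc++ (S.A k) (S.v1 k))))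
                    (cong (λ z → length z + r) (dec-enc (S.A k ++ S.v1 k))))

    cNP : Computable₁ p
    cNP = prec zer pstep , λ { (k ∷ []) → go k }
      where go : ∀ k → prec zer pstep ⟦ k ∷ [] ⟧⇓ p k
            go zero = ev-prec0 ev-zer
            go (suc k) = ev-precS (go k) (pstepOK k (p k))

    -- The characteristic function of ξ on coded positions n = 2h or 2h+1: read
    -- W_{n+1} at p_{n+1} ± h (the window for ξ(i) used in the construction).
    outG : ℕ → ℕ → ℕ → ℕ
    outG n a b = nsg a * bitN (eW (suc n)) (p (suc n) + b) + a * (sg b * bitN (eW (suc n)) (p (suc n) ∸ b))

    out : ℕ → ℕ
    out n = outG n (par n) (half n)

    cOut : Computable₁ out
    cOut = cExt (ap2 cAdd (ap2 cMul (cNsg $1 pa) (ap2 cBit x (ap2 cAdd P hf)))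
                          (ap2 cMul pa (ap2 cMul (cSg $1 hf) (ap2 cBit x (ap2 cMonus P hf)))))
                λ { (n ∷ []) → refl }
      where
        pa = cPar $1 cP {1} zero
        hf = cHalf $1 cP {1} zero
        x = cNW $1 cS $1 cP {1} zero
        P = cNP $1 cS $1 cP {1} zero

    -- Even positions 2h read
    -- ξ(h) from W_{2h+1}; odd position 1 is not used (value 0); position
    -- 2(j+1)+1 reads ξ(-(j+1)) from W_{2j+4} -- exactly the windows defining ξ.
    select-first : ∀ x y → 1 * x + 0 * y ≡ x
    select-first x y = trans (+-identityʳ (1 * x)) (+-identityʳ x)

    evenC : ∀ h → out (h + h) ≡ b2n (wb ξ (par (h + h)) (half (h + h)))
    evenC h = trans (cong₂ (outG (h + h)) p0 p1)
              (trans (trans (select-first (bitN (eW (suc (h + h))) (p (suc (h + h)) + h)) (sg h * bitN (eW (suc (h + h))) (p (suc (h + h)) ∸ h))) (bit-enc (Wn (suc (h + h))) (p (suc (h + h)) + h)))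
                     (sym (cong₂ (λ a b → b2n (wb ξ a b)) p0 p1)))
      where p0 = proj₁ (pe h)
            p1 = proj₂ (pe h)

    select-second : ∀ x y → nsg 1 * x + 1 * (1 * y) ≡ y
    select-second x y = trans (+-identityʳ (1 * y)) (+-identityʳ y)

    oddGen : ∀ n j → outG n 1 (suc j) ≡ b2n (nth (Wn (suc n)) (p (suc n) ∸ suc j))
    oddGen n j = trans (cong (λ z → nsg 1 * X + 1 * (z * Y)) (sg-suc j)) (trans (select-second X Y) (bit-enc (Wn (suc n)) (p (suc n) ∸ suc j)))
      where X = bitN (eW (suc n)) (p (suc n) + suc j)
            Y = bitN (eW (suc n)) (p (suc n) ∸ suc j)

    oddG : ∀ h → outG (suc (h + h)) 1 h ≡ b2n (wb ξ 1 h)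
    oddG zero = ar0 (bitN (eW (suc (suc (zero + zero)))) (p (suc (suc (zero + zero))) + zero))
                    (bitN (eW (suc (suc (zero + zero)))) (p (suc (suc (zero + zero))) ∸ zero))
      where ar0 : ∀ x y → nsg 1 * x + 1 * (sg 0 * y) ≡ 0
            ar0 x y = refl
    oddG (suc j) = trans (oddGen (suc (suc j + suc j)) j) (cong (λ z → b2n (nth (Wn (suc (suc z))) (p (suc (suc z)) ∸ suc j))) e)
      where e : suc j + suc j ≡ suc (suc (j + j))
            e = cong suc (+-suc j j)

    oddC : ∀ h → out (suc (h + h)) ≡ b2n (wb ξ (par (suc (h + h))) (half (suc (h + h))))
    oddC h = trans (cong₂ (outG (suc (h + h))) qa qb) (trans (oddG h) (sym (cong₂ (λ a b → b2n (wb ξ a b)) qa qb)))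
      where p0 = proj₁ (pe h)
            p1 = proj₂ (pe h)
            qa : par (suc (h + h)) ≡ 1
            qa = cong nsg p0
            qb : half (suc (h + h)) ≡ h
            qb = trans (cong₂ _+_ p1 p0) (+-identityʳ h)

    outWB : ∀ n → out n ≡ b2n (wb ξ (par n) (half n))
    outWB n = Data.Sum.[ (λ q → subst P (sym (trans (proj₂ q) (cong (λ z → half n + z) (+-identityʳ (half n))))) (evenC (half n)))
                       , (λ q → subst P (sym (trans (proj₂ q) (cong (λ z → suc (half n + z)) (+-identityʳ (half n))))) (oddC (half n))) ]′ (par-half n)
      where P : ℕ → Set
            P z = out z ≡ b2n (wb ξ (par z) (half z))

    outOK : ∀ n → out n ≡ b2n (wordBit ξ n)
    outOK n = trans (outWB n) (cong b2n (sym (wordBit-eq ξ n)))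

    recξ : RecursiveBiWord ξ
    recξ = indicator→recursive (wordBit ξ) (cExt cOut λ { (n ∷ []) → outOK n })

open Characterisation using (module NecessaryConditions; module Sufficiency)
open RecursiveWordToRE using (module RecursiveToRE)
open REToRecursiveWord using (module REToRecursive)

lemma5p2 : (L : Lang) →
    ((Σ BiWord λ ξ → Recurrent ξ × FactorsAre ξ L) ⇔ CondII L)
    × ((Σ BiWord λ ξ → Recurrent ξ × FactorsAre ξ L) →
    ((Σ BiWord λ ξ → Recurrent ξ × FactorsAre ξ L × RecursiveBiWord ξ) ⇔ RELang L))
lemma5p2 L = mk⇔ necessary sufficient , recursive⇔re
  where
    necessary : (Σ BiWord λ ξ → Recurrent ξ × FactorsAre ξ L) → CondII L
    necessary (ξ , rec , fac) = NecessaryConditions.condII L ξ rec fac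

    sufficient : CondII L → Σ BiWord λ ξ → Recurrent ξ × FactorsAre ξ L
    sufficient c = let open Sufficiency L c in ξ , recurrent , factors

    recursive⇔re : (Σ BiWord λ ξ → Recurrent ξ × FactorsAre ξ L) →
                   ((Σ BiWord λ ξ → Recurrent ξ × FactorsAre ξ L × RecursiveBiWord ξ) ⇔ RELang L)
    recursive⇔re ex = mk⇔ (λ { (ξ , rec , fac , recξ) → RecursiveToRE.re L ξ rec fac recξ })
                          (λ re → let open REToRecursive L (necessary ex) re in ξ , recurrent , factors , recξ)
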